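{- Let $n\ge 2$. Define $F$ on admitted vectors by $F(v)=[a_1,\ldots,a_n]$ with $a_i=i+\sum_{p<i}v_{pi}-\sum_{p>i}v_{ip}$. Let $f_c\in\tilde S_n$ be the affine permutation with window $[c_1,\ldots,c_n]$, where $c_1=-\tfrac12 n(n-3)$ and $c_{i+1}=c_i+n-1$ for $1\le i\le n-1$. Then $F$ is a poset isomorphism from the set of admitted vectors (ordered componentwise) onto the interval $[\mathrm{id},f_c]$ of $\tilde S_n$ with the left weak order.
   Context: $T=\{(i,j):1\le i<j\le n\}$; $v\in\mathbb N^T$ is admitted if $v_{i,i+1}=0$ and $v_{ij}+v_{jk}\le v_{ik}\le v_{ij}+v_{jk}+1$ for all $i<j<k$. The affine symmetric group $\tilde S_n$ is the group of bijections $f:\mathbb Z\to\mathbb Z$ with $f(x+n)=f(x)+n$ for all $x$ and $f(1)+\cdots+f(n)=n(n+1)/2$; $f$ is identified with its window $[f(1),\ldots,f(n)]$. It is generated by $s_0,\ldots,s_{n-1}$, where $s_k$ exchanges $x$ and $x+1$ for every $x\equiv k\pmod n$ and fixes the other integers. The length is $\ell(f)=|\{(i,j):1\le i\le n,\ i<j,\ f(i)>f(j)\}|$. The left weak order is the reflexive transitive closure of the covering relation: $g$ covers $f$ if $g=s_k\circ f$ for some $k$ and $\ell(g)=\ell(f)+1$. -}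

module Defs where

open import Data.Nat as ℕ using (ℕ; zero; suc; _∸_)
open import Data.Integer as ℤ using (ℤ; +_; -_; _+_; _-_; _*_; _<_; _≤_)
open import Data.Integer.DivMod using (_/ℕ_; _%ℕ_)
open import Data.Product using (Σ; ∃; _×_; _,_)
open import Data.List using (List; length)
open import Data.List.Membership.Propositional using (_∈_)
open import Data.List.Relation.Unary.Unique.Propositional using (Unique)
open import Function.Bundles using (_⇔_)
open import Function.Definitions using (Bijective)
open import Relation.Binary.PropositionalEquality using (_≡_)
open import Relation.Nullary using (yes; no)

-- Vectors indexed by T = {(i,j) : 1 ≤ i < j ≤ n}.
-- A vector v ∈ ℕ^T is represented by v : ℕ → ℕ → ℕ, where only the
-- entries v i j with 1 ≤ i < j ≤ n are meaningful (all statements only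
-- inspect those entries).

InT : ℕ → ℕ → ℕ → Set
InT n i j = (1 ℕ.≤ i) × (i ℕ.< j) × (j ℕ.≤ n)

Admitted : ℕ → (ℕ → ℕ → ℕ) → Set
Admitted n v =
  (∀ i → 1 ℕ.≤ i → suc i ℕ.≤ n → v i (suc i) ≡ 0) ×
  (∀ i j k → 1 ℕ.≤ i → i ℕ.< j → j ℕ.< k → k ℕ.≤ n →
     (v i j ℕ.+ v j k ℕ.≤ v i k) × (v i k ℕ.≤ suc (v i j ℕ.+ v j k)))

_≤[_]T_ : (ℕ → ℕ → ℕ) → ℕ → (ℕ → ℕ → ℕ) → Set
v ≤[ n ]T w = ∀ i j → InT n i j → v i j ℕ.≤ w i j

sumTo : ℕ → (ℕ → ℕ) → ℕ
sumTo zero    f = 0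
sumTo (suc k) f = sumTo k f ℕ.+ f (suc k)

sumToℤ : ℕ → (ℕ → ℤ) → ℤ
sumToℤ zero    f = + 0
sumToℤ (suc k) f = sumToℤ k f + f (suc k)

Fwin : ℕ → (ℕ → ℕ → ℕ) → ℕ → ℤ
Fwin n v i = (+ i + + sumTo (i ∸ 1) (λ p → v p i))
             - + sumTo (n ∸ i) (λ t → v i (i ℕ.+ t))

-- The affine map ℤ → ℤ with window a (indices 1..n):
-- f(r + 1 + q n) = a (r+1) + q n for 0 ≤ r < n.
ext : ℕ → (ℕ → ℤ) → ℤ → ℤ
ext zero    a x = x
ext (suc k) a x = a (suc ((x - + 1) %ℕ suc k)) + ((x - + 1) /ℕ suc k) * + suc k

IsAffPerm : ℕ → (ℤ → ℤ) → Set
IsAffPerm n f =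
  Bijective _≡_ _≡_ f ×
  (∀ x → f (x + + n) ≡ f x + + n) ×
  (+ 2 * sumToℤ n (λ i → f (+ i)) ≡ + (n ℕ.* suc n))

s : ℕ → ℕ → ℤ → ℤ
s zero    k x = x
s (suc m) k x with x %ℕ suc m ℕ.≟ k ℕ.% suc m
... | yes _ = x + + 1
... | no _ with x %ℕ suc m ℕ.≟ suc k ℕ.% suc m
...   | yes _ = x - + 1
...   | no _  = x

Inv : ℕ → (ℤ → ℤ) → ℤ × ℤ → Set
Inv n f (i , j) = (+ 1 ≤ i) × (i ≤ + n) × (i < j) × (f j < f i)

-- Len n f m : ℓ(f) = m, i.e. the inversion set is finite with m elements
Len : ℕ → (ℤ → ℤ) → ℕ → Set
Len n f m = Σ (List (ℤ × ℤ)) λ l →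
  Unique l × (length l ≡ m) × (∀ p → (p ∈ l) ⇔ Inv n f p)

Covers : ℕ → (ℤ → ℤ) → (ℤ → ℤ) → Set
Covers n f g = Σ ℕ λ k → (k ℕ.< n) × (∀ x → g x ≡ s n k (f x)) ×
  (Σ ℕ λ m → Len n f m × Len n g (suc m))

-- left weak order: reflexive transitive closure of the covering relation
-- (functions are compared extensionally)
data LeftWeak (n : ℕ) : (ℤ → ℤ) → (ℤ → ℤ) → Set where
  ≤-refl : ∀ {f g} → (∀ x → f x ≡ g x) → LeftWeak n f g
  ≤-step : ∀ {f g h} → LeftWeak n f g → Covers n g h → LeftWeak n f h

idℤ : ℤ → ℤ
idℤ x = x

cwin : ℕ → ℕ → ℤ
cwin n zero          = + 0   -- unused
cwin n (suc zero)    = - ((+ n * (+ n - + 3)) /ℕ 2)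
cwin n (suc (suc i)) = cwin n (suc i) + (+ n - + 1)

fc : ℕ → ℤ → ℤ
fc n = ext n (cwin n)

InInterval : ℕ → (ℤ → ℤ) → Set
InInterval n g = IsAffPerm n g × LeftWeak n idℤ g × LeftWeak n g (fc n)

module Submission where

-- For an admitted v with window a = F(v), each difference a_j − a_i (i < j) is a sum of n
-- terms ψ lying in {v_ij, v_ij + 1}, at least one of each kind, by the triangle
-- inequalities.  Hence v_ij N < a_j − a_i < v_ij N + N: the table v is the table of floors
-- of window differences, F(v) is an affine permutation, and its inversions are exactly the
-- pairs (j, i + tN) with i < j and 1 ≤ t ≤ v_ij.  Conversely such a floor table is always
-- admitted.  Raising one entry v_ij by one is left multiplication by the simple reflection
-- swapping the values a_j and a_j + 1, which adds exactly the inversion (j, i + (v_ij+1)N);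
-- since every cover adds exactly one inversion, chains of covers correspond to chains of
-- tables raised entry by entry.  The largest admitted table v_ij = j − i − 1 is sent to f_c.

open import Data.Nat as ℕ using (ℕ; zero; suc; z≤n; s≤s; _∸_)
import Data.Nat.Properties as ℕP
import Data.Nat.DivMod as ℕD
import Data.Nat.Tactic.RingSolver as ℕRing
open import Data.Integer as ℤ using (ℤ; +_; -[1+_]; _+_; _-_; _*_; -_; _<_; _≤_; +≤+; +<+; ∣_∣)
open import Data.Integer.Properties hiding (≤-refl; ≤-step)
import Data.Integer.Properties as ℤP
open import Data.Integer.DivMod using (_/ℕ_; _%ℕ_; n%ℕd<d; a≡a%ℕn+[a/ℕn]*n)
open import Data.Integer.Tactic.RingSolver using (solve-∀)
open import Data.Fin as Fin using (Fin; toℕ; fromℕ<; punchOut)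
import Data.Fin.Properties as FP
open import Data.List using (List; []; _∷_; length; filter)
open import Data.List.Properties using (filter-notAll)
open import Data.List.Membership.Propositional using (_∈_; _∉_)
open import Data.List.Membership.Propositional.Properties using (∈-filter⁺)
open import Data.List.Relation.Unary.Any as Any using (here; there)
import Data.List.Relation.Unary.All as All
open import Data.List.Relation.Unary.Unique.Propositional using (Unique)
open import Data.List.Relation.Unary.Unique.Propositional.Properties using (Unique[x∷xs]⇒x∉xs)
open import Data.List.Relation.Unary.AllPairs using ([]; _∷_)
open import Data.Product using (Σ; ∃; _×_; _,_; proj₁; proj₂)
open import Data.Product.Properties using (≡-dec)
open import Data.Sum using (_⊎_; inj₁; inj₂)
open import Data.Empty using (⊥; ⊥-elim)
open import Function.Bundles using (Equivalence; mk⇔; _⇔_)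
open import Relation.Binary.Definitions using (DecidableEquality; Tri; tri<; tri≈; tri>)
open import Relation.Binary.PropositionalEquality
open import Relation.Nullary using (¬_; Dec; yes; no; ¬?)
open import Defs

module _ {A : Set} (_≟_ : DecidableEquality A) where

  private
    remove : A → List A → List A
    remove a = filter (λ x → ¬? (x ≟ a))

    length-remove< : ∀ {a xs} → a ∈ xs → length (remove a xs) ℕ.< length xs
    length-remove< {a} {xs} a∈xs = filter-notAll (λ x → ¬? (x ≟ a)) xs (Any.map (λ e ne → ne (sym e)) a∈xs)

  Unique-⊆⇒length≤ : ∀ (ys xs : List A) → Unique ys → (∀ {z} → z ∈ ys → z ∈ xs) → length ys ℕ.≤ length xs
  Unique-⊆⇒length≤ [] xs _ _ = z≤n
  Unique-⊆⇒length≤ (y ∷ ys) xs u@(_ ∷ u') ys⊆xs =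
    ℕP.<-≤-trans (s≤s (Unique-⊆⇒length≤ ys (remove y xs) u' ys⊆xs-y)) (length-remove< (ys⊆xs (here refl)))
    where
    ys⊆xs-y : ∀ {z} → z ∈ ys → z ∈ remove y xs
    ys⊆xs-y z∈ys = ∈-filter⁺ (λ x → ¬? (x ≟ y)) (ys⊆xs (there z∈ys)) (λ e → Unique[x∷xs]⇒x∉xs u (subst (_∈ ys) e z∈ys))

  Unique-⊂⇒length< : ∀ (ys xs : List A) a → Unique ys → (∀ {z} → z ∈ ys → z ∈ xs) → a ∈ xs → a ∉ ys →
                     length ys ℕ.< length xs
  Unique-⊂⇒length< ys xs a u ys⊆xs a∈xs a∉ys =
    ℕP.≤-<-trans (Unique-⊆⇒length≤ ys (remove a xs) u ys⊆xs-a) (length-remove< a∈xs)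
    where
    ys⊆xs-a : ∀ {z} → z ∈ ys → z ∈ remove a xs
    ys⊆xs-a z∈ys = ∈-filter⁺ (λ x → ¬? (x ≟ a)) (ys⊆xs z∈ys) (λ e → a∉ys (subst (_∈ ys) e z∈ys))

≤⇒gap : ∀ {a b : ℤ} → a ≤ b → ∃ λ c → b ≡ a + + c
≤⇒gap {a} {b} a≤b = ∣ b - a ∣ , (begin
  b               ≡⟨ ring a b ⟩
  a + (b - a)     ≡⟨ cong (λ z → a + z) (sym (0≤i⇒+∣i∣≡i (i≤j⇒0≤j-i a≤b))) ⟩
  a + + ∣ b - a ∣ ∎)
  where
  open ≡-Reasoning
  ring : ∀ a b → b ≡ a + (b - a)
  ring = solve-∀

<⇒gap : ∀ {a b : ℤ} → a < b → ∃ λ c → b ≡ a + + suc c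
<⇒gap {a} a<b with ≤⇒gap (i<j⇒suc[i]≤j a<b)
... | c , e = c , trans e (ring a (+ c))
  where
  ring : ∀ a c → + 1 + a + c ≡ a + (+ 1 + c)
  ring = solve-∀

gap⇒≤ : ∀ {a b : ℤ} c → b ≡ a + + c → a ≤ b
gap⇒≤ {a} c e = subst (a ≤_) (sym e) (i≤i+j a (+ c))

gap⇒< : ∀ {a b : ℤ} c → b ≡ a + + suc c → a < b
gap⇒< {a} c e = suc[i]≤j⇒i<j (gap⇒≤ c (trans e (ring a (+ c))))
  where
  ring : ∀ a c → a + (+ 1 + c) ≡ (+ 1 + a) + c
  ring = solve-∀

i<i+1 : ∀ (i : ℤ) → i < i + + 1
i<i+1 i = gap⇒< 0 refl

<-resp-difference : ∀ {x y} x' y' → x < y → x' - y' ≡ x - y → x' < y'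
<-resp-difference {x} x' y' x<y e with <⇒gap x<y
... | c , refl = gap⇒< c (trans (ring₁ x' y') (trans (cong (λ z → x' - z) e) (ring₂ x' x (+ suc c))))
  where
  ring₁ : ∀ x' y' → y' ≡ x' - (x' - y')
  ring₁ = solve-∀
  ring₂ : ∀ x' x c → x' - (x - (x + c)) ≡ x' + c
  ring₂ = solve-∀

≤-resp-difference : ∀ {x y} x' y' → x ≤ y → x' - y' ≡ x - y → x' ≤ y'
≤-resp-difference {x} x' y' x≤y e with ≤⇒gap x≤y
... | c , refl = gap⇒≤ c (trans (ring₁ x' y') (trans (cong (λ z → x' - z) e) (ring₂ x' x (+ c))))
  where
  ring₁ : ∀ x' y' → y' ≡ x' - (x' - y')
  ring₁ = solve-∀
  ring₂ : ∀ x' x c → x' - (x - (x + c)) ≡ x' + c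
  ring₂ = solve-∀

+-cancelʳ : ∀ a b c → a + c ≡ b + c → a ≡ b
+-cancelʳ a b c e = trans (ring a c) (trans (cong (_- c) e) (sym (ring b c)))
  where
  ring : ∀ a c → a ≡ a + c - c
  ring = solve-∀

≮∧≢⇒> : ∀ {a b : ℤ} → ¬ (a < b) → a ≢ b → b < a
≮∧≢⇒> a≮b a≢b = ≤∧≢⇒< (≮⇒≥ a≮b) (λ e → a≢b (sym e))

+≤+⁻¹ : ∀ {a b} → + a ≤ + b → a ℕ.≤ b
+≤+⁻¹ (+≤+ p) = p

+<+⁻¹ : ∀ {a b} → + a < + b → a ℕ.< b
+<+⁻¹ (+<+ p) = p

-- Finite sums

sumTo-cong : ∀ k (f g : ℕ → ℕ) → (∀ p → 1 ℕ.≤ p → p ℕ.≤ k → f p ≡ g p) → sumTo k f ≡ sumTo k g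
sumTo-cong zero    f g f≗g = refl
sumTo-cong (suc k) f g f≗g =
  cong₂ ℕ._+_ (sumTo-cong k f g (λ p 1≤p p≤k → f≗g p 1≤p (ℕP.m≤n⇒m≤1+n p≤k))) (f≗g (suc k) (s≤s z≤n) ℕP.≤-refl)

sumToℤ-cong : ∀ k (f g : ℕ → ℤ) → (∀ p → 1 ℕ.≤ p → p ℕ.≤ k → f p ≡ g p) → sumToℤ k f ≡ sumToℤ k g
sumToℤ-cong zero    f g f≗g = refl
sumToℤ-cong (suc k) f g f≗g =
  cong₂ _+_ (sumToℤ-cong k f g (λ p 1≤p p≤k → f≗g p 1≤p (ℕP.m≤n⇒m≤1+n p≤k))) (f≗g (suc k) (s≤s z≤n) ℕP.≤-refl)

sumTo-zero : ∀ k → sumTo k (λ _ → 0) ≡ 0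
sumTo-zero zero    = refl
sumTo-zero (suc k) = trans (ℕP.+-identityʳ _) (sumTo-zero k)

+-sumTo : ∀ k f → + sumTo k f ≡ sumToℤ k (λ p → + f p)
+-sumTo zero    f = refl
+-sumTo (suc k) f = trans (pos-+ (sumTo k f) (f (suc k))) (cong (_+ + f (suc k)) (+-sumTo k f))

sumToℤ-split : ∀ a b (f : ℕ → ℤ) → sumToℤ (a ℕ.+ b) f ≡ sumToℤ a f + sumToℤ b (λ t → f (a ℕ.+ t))
sumToℤ-split a zero    f = trans (cong (λ z → sumToℤ z f) (ℕP.+-identityʳ a)) (sym (+-identityʳ _))
sumToℤ-split a (suc b) f = begin
  sumToℤ (a ℕ.+ suc b) f                                        ≡⟨ cong (λ z → sumToℤ z f) (ℕP.+-suc a b) ⟩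
  sumToℤ (a ℕ.+ b) f + f (suc (a ℕ.+ b))                        ≡⟨ cong₂ _+_ (sumToℤ-split a b f) (cong f (sym (ℕP.+-suc a b))) ⟩
  sumToℤ a f + sumToℤ b (λ t → f (a ℕ.+ t)) + f (a ℕ.+ suc b)   ≡⟨ +-assoc (sumToℤ a f) _ _ ⟩
  sumToℤ a f + (sumToℤ b (λ t → f (a ℕ.+ t)) + f (a ℕ.+ suc b)) ∎
  where open ≡-Reasoning

sumToℤ-+ : ∀ k (f g : ℕ → ℤ) → sumToℤ k (λ p → f p + g p) ≡ sumToℤ k f + sumToℤ k g
sumToℤ-+ zero    f g = refl
sumToℤ-+ (suc k) f g =
  trans (cong (_+ (f (suc k) + g (suc k))) (sumToℤ-+ k f g)) (ring (sumToℤ k f) (sumToℤ k g) (f (suc k)) (g (suc k)))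
  where
  ring : ∀ a b c d → a + b + (c + d) ≡ a + c + (b + d)
  ring = solve-∀

sumToℤ-neg : ∀ k (f : ℕ → ℤ) → sumToℤ k (λ p → - f p) ≡ - sumToℤ k f
sumToℤ-neg zero    f = refl
sumToℤ-neg (suc k) f = trans (cong (_+ (- f (suc k))) (sumToℤ-neg k f)) (sym (neg-distrib-+ (sumToℤ k f) (f (suc k))))

sumToℤ-const : ∀ k (c : ℤ) → sumToℤ k (λ _ → c) ≡ c * + k
sumToℤ-const zero    c = sym (*-zeroʳ c)
sumToℤ-const (suc k) c = trans (cong (_+ c) (sumToℤ-const k c)) (ring c (+ k))
  where
  ring : ∀ c k → c * k + c ≡ c * (+ 1 + k)
  ring = solve-∀

sumToℤ-swap : ∀ a b (f : ℕ → ℕ → ℤ) →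
              sumToℤ a (λ i → sumToℤ b (λ p → f i p)) ≡ sumToℤ b (λ p → sumToℤ a (λ i → f i p))
sumToℤ-swap zero    b f = sym (trans (sumToℤ-const b (+ 0)) (*-zeroˡ (+ b)))
sumToℤ-swap (suc a) b f = trans (cong (_+ sumToℤ b (λ p → f (suc a) p)) (sumToℤ-swap a b f))
                                (sym (sumToℤ-+ b (λ p → sumToℤ a (λ i → f i p)) (λ p → f (suc a) p)))

sumToℤ-mono-≤ : ∀ k (f g : ℕ → ℤ) → (∀ p → 1 ℕ.≤ p → p ℕ.≤ k → f p ≤ g p) → sumToℤ k f ≤ sumToℤ k g
sumToℤ-mono-≤ zero    f g f≤g = ℤP.≤-refl
sumToℤ-mono-≤ (suc k) f g f≤g =
  +-mono-≤ (sumToℤ-mono-≤ k f g (λ p 1≤p p≤k → f≤g p 1≤p (ℕP.m≤n⇒m≤1+n p≤k))) (f≤g (suc k) (s≤s z≤n) ℕP.≤-refl)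

sumToℤ-mono-< : ∀ k (f g : ℕ → ℤ) → (∀ p → 1 ℕ.≤ p → p ℕ.≤ k → f p ≤ g p) →
                ∀ p₀ → 1 ℕ.≤ p₀ → p₀ ℕ.≤ k → f p₀ < g p₀ → sumToℤ k f < sumToℤ k g
sumToℤ-mono-< zero f g f≤g .zero () z≤n fp₀<gp₀
sumToℤ-mono-< (suc k) f g f≤g p₀ 1≤p₀ p₀≤k fp₀<gp₀ with p₀ ℕ.≟ suc k
... | yes refl = +-mono-≤-< (sumToℤ-mono-≤ k f g f≤g-below) fp₀<gp₀
  where f≤g-below = λ p 1≤p p≤k → f≤g p 1≤p (ℕP.m≤n⇒m≤1+n p≤k)
... | no p₀≢k = +-mono-<-≤ (sumToℤ-mono-< k f g f≤g-below p₀ 1≤p₀ (ℕP.≤-pred (ℕP.≤∧≢⇒< p₀≤k p₀≢k)) fp₀<gp₀)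
                           (f≤g (suc k) (s≤s z≤n) ℕP.≤-refl)
  where f≤g-below = λ p 1≤p p≤k → f≤g p 1≤p (ℕP.m≤n⇒m≤1+n p≤k)

sumTo-mono-≤ : ∀ k (f g : ℕ → ℕ) → (∀ p → 1 ℕ.≤ p → p ℕ.≤ k → f p ℕ.≤ g p) → sumTo k f ℕ.≤ sumTo k g
sumTo-mono-≤ zero    f g f≤g = z≤n
sumTo-mono-≤ (suc k) f g f≤g =
  ℕP.+-mono-≤ (sumTo-mono-≤ k f g (λ p 1≤p p≤k → f≤g p 1≤p (ℕP.m≤n⇒m≤1+n p≤k))) (f≤g (suc k) (s≤s z≤n) ℕP.≤-refl)

sumTo-mono-< : ∀ k (f g : ℕ → ℕ) → (∀ p → 1 ℕ.≤ p → p ℕ.≤ k → f p ℕ.≤ g p) →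
               ∀ p₀ → 1 ℕ.≤ p₀ → p₀ ℕ.≤ k → f p₀ ℕ.< g p₀ → sumTo k f ℕ.< sumTo k g
sumTo-mono-< zero f g f≤g .zero () z≤n fp₀<gp₀
sumTo-mono-< (suc k) f g f≤g p₀ 1≤p₀ p₀≤k fp₀<gp₀ with p₀ ℕ.≟ suc k
... | yes refl = ℕP.+-mono-≤-< (sumTo-mono-≤ k f g f≤g-below) fp₀<gp₀
  where f≤g-below = λ p 1≤p p≤k → f≤g p 1≤p (ℕP.m≤n⇒m≤1+n p≤k)
... | no p₀≢k = ℕP.+-mono-<-≤ (sumTo-mono-< k f g f≤g-below p₀ 1≤p₀ (ℕP.≤-pred (ℕP.≤∧≢⇒< p₀≤k p₀≢k)) fp₀<gp₀)
                              (f≤g (suc k) (s≤s z≤n) ℕP.≤-refl)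
  where f≤g-below = λ p 1≤p p≤k → f≤g p 1≤p (ℕP.m≤n⇒m≤1+n p≤k)

sumTo-bump : ∀ k (f f' : ℕ → ℕ) p₀ → 1 ℕ.≤ p₀ → p₀ ℕ.≤ k → f' p₀ ≡ suc (f p₀) → (∀ p → p ≢ p₀ → f' p ≡ f p) →
             sumTo k f' ≡ suc (sumTo k f)
sumTo-bump zero f f' .zero () z≤n bumped elsewhere
sumTo-bump (suc k) f f' p₀ 1≤p₀ p₀≤k bumped elsewhere with p₀ ℕ.≟ suc k
... | yes refl = trans (cong₂ ℕ._+_ (sumTo-cong k f' f (λ p _ p≤k → elsewhere p (λ e → ℕP.<-irrefl e (s≤s p≤k)))) bumped)
                       (ℕP.+-suc (sumTo k f) (f (suc k)))
... | no p₀≢k = cong₂ ℕ._+_ (sumTo-bump k f f' p₀ 1≤p₀ (ℕP.≤-pred (ℕP.≤∧≢⇒< p₀≤k p₀≢k)) bumped elsewhere)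
                            (elsewhere (suc k) (λ e → p₀≢k (sym e)))

sumToℤ-bump : ∀ k (f f' : ℕ → ℤ) p₀ δ → 1 ℕ.≤ p₀ → p₀ ℕ.≤ k → f' p₀ ≡ f p₀ + δ → (∀ p → p ≢ p₀ → f' p ≡ f p) →
              sumToℤ k f' ≡ sumToℤ k f + δ
sumToℤ-bump zero f f' .zero δ () z≤n bumped elsewhere
sumToℤ-bump (suc k) f f' p₀ δ 1≤p₀ p₀≤k bumped elsewhere with p₀ ℕ.≟ suc k
... | yes refl = trans (cong₂ _+_ (sumToℤ-cong k f' f (λ p _ p≤k → elsewhere p (λ e → ℕP.<-irrefl e (s≤s p≤k)))) bumped)
                       (sym (+-assoc (sumToℤ k f) (f (suc k)) δ))
... | no p₀≢k = trans (cong₂ _+_ (sumToℤ-bump k f f' p₀ δ 1≤p₀ (ℕP.≤-pred (ℕP.≤∧≢⇒< p₀≤k p₀≢k)) bumped elsewhere)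
                                  (elsewhere (suc k) (λ e → p₀≢k (sym e))))
                      (ring (sumToℤ k f) δ (f (suc k)))
  where
  ring : ∀ a b c → a + b + c ≡ a + c + b
  ring = solve-∀

2*sumTo-pred : ∀ k → 2 ℕ.* sumTo k (λ t → t ∸ 1) ≡ k ℕ.* (k ∸ 1)
2*sumTo-pred zero          = refl
2*sumTo-pred (suc zero)    = refl
2*sumTo-pred (suc (suc k)) =
  trans (ℕP.*-distribˡ-+ 2 (sumTo (suc k) (λ t → t ∸ 1)) (suc k))
        (trans (cong (ℕ._+ 2 ℕ.* suc k) (2*sumTo-pred (suc k))) (ring k))
  where
  ring : ∀ k → (1 ℕ.+ k) ℕ.* k ℕ.+ 2 ℕ.* (1 ℕ.+ k) ≡ (2 ℕ.+ k) ℕ.* (1 ℕ.+ k)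
  ring = ℕRing.solve-∀

allBelow⊎someBelow : ∀ {P Q : ℕ → Set} → (∀ i → P i ⊎ Q i) → ∀ k → (∀ i → i ℕ.< k → P i) ⊎ ∃ λ i → i ℕ.< k × Q i
allBelow⊎someBelow P⊎Q zero = inj₁ (λ i ())
allBelow⊎someBelow P⊎Q (suc k) with allBelow⊎someBelow P⊎Q k | P⊎Q k
... | inj₂ (i , i<k , q) | _     = inj₂ (i , ℕP.m≤n⇒m≤1+n i<k , q)
... | inj₁ _             | inj₂ q = inj₂ (k , ℕP.≤-refl , q)
... | inj₁ all           | inj₁ p = inj₁ (λ i i≤k → below-or-at i (ℕP.m≤n⇒m<n∨m≡n (ℕP.≤-pred i≤k)))
  where
  below-or-at : ∀ i → i ℕ.< k ⊎ i ≡ k → _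
  below-or-at i (inj₁ i<k)  = all i i<k
  below-or-at i (inj₂ refl) = p

+suc-suc : ∀ x D → x + + suc (suc D) ≡ x + + 1 + + suc D
+suc-suc x D = ring x (+ D)
  where
  ring : ∀ x d → x + (+ 1 + (+ 1 + d)) ≡ x + + 1 + (+ 1 + d)
  ring = solve-∀

-- If f is surjective and g keeps every f-inversion, a g-inversion p < p' with f p < f p'
-- contains an f-ascent q < q' with f q' = f q + 1 that is still a g-inversion: walk
-- along the values f p + 1, f p + 2, …, each of which is taken somewhere.
ascent-inverted-somewhere :
  ∀ (f g : ℤ → ℤ) → (∀ z → ∃ λ x → f x ≡ z) → (∀ x y → x < y → f y < f x → g y < g x) →
  ∀ (D : ℕ) p p' → p < p' → f p' ≡ f p + + suc D → g p' < g p →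
  ∃ λ q → ∃ λ q' → q < q' × f q' ≡ f q + + 1 × g q' < g q
ascent-inverted-somewhere f g surj keeps zero p p' p<p' e gp'<gp = p , p' , p<p' , e , gp'<gp
ascent-inverted-somewhere f g surj keeps (suc D) p p' p<p' e gp'<gp with surj (f p + + 1)
... | r , fr with <-cmp r p
...   | tri< r<p _ _ =
  ascent-inverted-somewhere f g surj keeps D r p' (<-trans r<p p<p') (trans e (trans (+suc-suc (f p) D) (cong (_+ + suc D) (sym fr))))
    (<-trans gp'<gp (keeps r p r<p (subst (f p <_) (sym fr) (i<i+1 (f p)))))
...   | tri≈ _ r≡p _ = ⊥-elim (<-irrefl (sym (trans (sym fr) (cong f r≡p))) (i<i+1 (f p)))
...   | tri> _ _ p<r with <-cmp r p'
...     | tri< r<p' _ _ with g r <? g p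
...       | yes gr<gp = p , r , p<r , fr , gr<gp
...       | no gr≮gp =
  ascent-inverted-somewhere f g surj keeps D r p' r<p' (trans e (trans (+suc-suc (f p) D) (cong (_+ + suc D) (sym fr))))
    (<-≤-trans gp'<gp (≮⇒≥ gr≮gp))
ascent-inverted-somewhere f g surj keeps (suc D) p p' p<p' e gp'<gp | r , fr | tri> _ _ p<r | tri≈ _ r≡p' _ =
  ⊥-elim (<-irrefl (trans (sym fr) (trans (cong f r≡p') e)) (gap⇒< D (+suc-suc (f p) D)))
ascent-inverted-somewhere f g surj keeps (suc D) p p' p<p' e gp'<gp | r , fr | tri> _ _ p<r | tri> _ _ p'<r =
  p , r , <-trans p<p' p'<r , fr , <-trans (keeps p' r p'<r (subst₂ _<_ (sym fr) (sym e) (gap⇒< D (+suc-suc (f p) D)))) gp'<gp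

-- Arithmetic modulo N and windows

module Window (k : ℕ) where

  N : ℕ
  N = suc k

  Nℤ : ℤ
  Nℤ = + N

  *N-step : ∀ {q q' : ℤ} → q < q' → q * Nℤ + Nℤ ≤ q' * Nℤ
  *N-step {q} q<q' with <⇒gap q<q'
  ... | c , refl = gap⇒≤ (c ℕ.* N) (trans (ring q (+ c) Nℤ) (cong (λ z → q * Nℤ + Nℤ + z) (sym (pos-* c N))))
    where
    ring : ∀ q c n → (q + (+ 1 + c)) * n ≡ q * n + n + c * n
    ring = solve-∀

  *N-mono-≤ : ∀ {q q' : ℤ} → q ≤ q' → q * Nℤ ≤ q' * Nℤ
  *N-mono-≤ = *-monoʳ-≤-nonNeg Nℤ

  divMod : ∀ x → ∃ λ r → ∃ λ q → r ℕ.< N × x ≡ + r + q * Nℤ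
  divMod x = x %ℕ N , x /ℕ N , n%ℕd<d x N , a≡a%ℕn+[a/ℕn]*n x N

  private
    smaller-quotient⇒⊥ : ∀ r r' q q' → r ℕ.< N → + r + q * Nℤ ≡ + r' + q' * Nℤ → q < q' → ⊥
    smaller-quotient⇒⊥ r r' q q' r<N e q<q' with ≤⇒gap (*N-step q<q')
    ... | c , e₂ = <-irrefl refl (≤-<-trans (gap⇒≤ (r' ℕ.+ c) r≡N+r'+c) (+<+ r<N))
      where
      r≡N+r'+c : + r ≡ Nℤ + + (r' ℕ.+ c)
      r≡N+r'+c = begin
        + r                                    ≡⟨ ring₁ (+ r) q Nℤ ⟩
        + r + q * Nℤ - q * Nℤ                  ≡⟨ cong (_- q * Nℤ) e ⟩
        + r' + q' * Nℤ - q * Nℤ                ≡⟨ cong (λ z → + r' + z - q * Nℤ) e₂ ⟩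
        + r' + (q * Nℤ + Nℤ + + c) - q * Nℤ    ≡⟨ ring₂ (+ r') q Nℤ (+ c) ⟩
        Nℤ + (+ r' + + c)                      ≡⟨ cong (λ z → Nℤ + z) (sym (pos-+ r' c)) ⟩
        Nℤ + + (r' ℕ.+ c)                      ∎
        where
        open ≡-Reasoning
        ring₁ : ∀ r q n → r ≡ r + q * n - q * n
        ring₁ = solve-∀
        ring₂ : ∀ r' q n c → r' + (q * n + n + c) - q * n ≡ n + (r' + c)
        ring₂ = solve-∀

  divMod-unique-q : ∀ r r' q q' → r ℕ.< N → r' ℕ.< N → + r + q * Nℤ ≡ + r' + q' * Nℤ → q ≡ q'
  divMod-unique-q r r' q q' r<N r'<N e with <-cmp q q'
  ... | tri≈ _ q≡q' _ = q≡q'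
  ... | tri< q<q' _ _ = ⊥-elim (smaller-quotient⇒⊥ r r' q q' r<N e q<q')
  ... | tri> _ _ q'<q = ⊥-elim (smaller-quotient⇒⊥ r' r q' q r'<N (sym e) q'<q)

  divMod-unique-r : ∀ r r' q q' → r ℕ.< N → r' ℕ.< N → + r + q * Nℤ ≡ + r' + q' * Nℤ → r ≡ r'
  divMod-unique-r r r' q q' r<N r'<N e with divMod-unique-q r r' q q' r<N r'<N e
  ... | refl = +-injective (+-cancelʳ (+ r) (+ r') (q * Nℤ) e)

  %ℕ-of-divMod : ∀ r q → r ℕ.< N → (+ r + q * Nℤ) %ℕ N ≡ r
  %ℕ-of-divMod r q r<N = sym (divMod-unique-r r (x %ℕ N) q (x /ℕ N) r<N (n%ℕd<d x N) (a≡a%ℕn+[a/ℕn]*n x N))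
    where x = + r + q * Nℤ

  /ℕ-of-divMod : ∀ r q → r ℕ.< N → (+ r + q * Nℤ) /ℕ N ≡ q
  /ℕ-of-divMod r q r<N = sym (divMod-unique-q r (x %ℕ N) q (x /ℕ N) r<N (n%ℕd<d x N) (a≡a%ℕn+[a/ℕn]*n x N))
    where x = + r + q * Nℤ

  windowDecomp : ∀ x → ∃ λ i → ∃ λ q → 1 ℕ.≤ i × i ℕ.≤ N × x ≡ + i + q * Nℤ
  windowDecomp x with divMod (x - + 1)
  ... | r , q , r<N , e = suc r , q , s≤s z≤n , r<N , trans (ring₁ x) (trans (cong (_+ + 1) e) (ring₂ (+ r) (q * Nℤ)))
    where
    ring₁ : ∀ x → x ≡ x - + 1 + + 1
    ring₁ = solve-∀
    ring₂ : ∀ a b → a + b + + 1 ≡ + 1 + a + b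
    ring₂ = solve-∀

  ext-window : ∀ (a : ℕ → ℤ) i q → 1 ℕ.≤ i → i ℕ.≤ N → ext N a (+ i + q * Nℤ) ≡ a i + q * Nℤ
  ext-window a (suc i) q _ i≤N =
    trans (cong (λ z → a (suc (z %ℕ N)) + (z /ℕ N) * Nℤ) (ring (+ i) (q * Nℤ)))
          (cong₂ (λ r d → a (suc r) + d * Nℤ) (%ℕ-of-divMod i q i≤N) (/ℕ-of-divMod i q i≤N))
    where
    ring : ∀ a b → + 1 + a + b - + 1 ≡ a + b
    ring = solve-∀

  ext-pos : ∀ (a : ℕ → ℤ) i → 1 ℕ.≤ i → i ℕ.≤ N → ext N a (+ i) ≡ a i
  ext-pos a i 1≤i i≤N = trans (cong (ext N a) (sym (ring (+ i) Nℤ))) (trans (ext-window a i (+ 0) 1≤i i≤N) (ring (a i) Nℤ))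
    where
    ring : ∀ x n → x + + 0 * n ≡ x
    ring = solve-∀

  ext-cong : ∀ a b → (∀ i → 1 ℕ.≤ i → i ℕ.≤ N → a i ≡ b i) → ∀ x → ext N a x ≡ ext N b x
  ext-cong a b a≗b x = cong (_+ ((x - + 1) /ℕ N) * Nℤ) (a≗b _ (s≤s z≤n) (n%ℕd<d (x - + 1) N))

  ext-id : ∀ x → ext N +_ x ≡ x
  ext-id x with windowDecomp x
  ... | i , q , 1≤i , i≤N , refl = ext-window +_ i q 1≤i i≤N

  Periodic : (ℤ → ℤ) → Set
  Periodic f = ∀ x → f (x + Nℤ) ≡ f x + Nℤ

  ext-periodic : ∀ a → Periodic (ext N a)
  ext-periodic a x with windowDecomp x
  ... | i , q , 1≤i , i≤N , refl = begin
    ext N a (+ i + q * Nℤ + Nℤ)       ≡⟨ cong (ext N a) (ring (+ i) q Nℤ) ⟩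
    ext N a (+ i + (q + + 1) * Nℤ)    ≡⟨ ext-window a i (q + + 1) 1≤i i≤N ⟩
    a i + (q + + 1) * Nℤ              ≡⟨ sym (ring (a i) q Nℤ) ⟩
    a i + q * Nℤ + Nℤ                 ≡⟨ cong (_+ Nℤ) (sym (ext-window a i q 1≤i i≤N)) ⟩
    ext N a (+ i + q * Nℤ) + Nℤ       ∎
    where
    open ≡-Reasoning
    ring : ∀ i q n → i + q * n + n ≡ i + (q + + 1) * n
    ring = solve-∀

  periodic-*N : ∀ f → Periodic f → ∀ x t → f (x + t * Nℤ) ≡ f x + t * Nℤ
  periodic-*N f per x (+ n) = periodic-+ n
    where
    periodic-+ : ∀ n → f (x + + n * Nℤ) ≡ f x + + n * Nℤ
    periodic-+ zero = trans (cong f (ring x Nℤ)) (sym (ring (f x) Nℤ))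
      where
      ring : ∀ x n → x + + 0 * n ≡ x
      ring = solve-∀
    periodic-+ (suc n) = begin
      f (x + + suc n * Nℤ)        ≡⟨ cong f (ring x (+ n) Nℤ) ⟩
      f (x + + n * Nℤ + Nℤ)       ≡⟨ per _ ⟩
      f (x + + n * Nℤ) + Nℤ       ≡⟨ cong (_+ Nℤ) (periodic-+ n) ⟩
      f x + + n * Nℤ + Nℤ         ≡⟨ sym (ring (f x) (+ n) Nℤ) ⟩
      f x + + suc n * Nℤ          ∎
      where
      open ≡-Reasoning
      ring : ∀ x n m → x + (+ 1 + n) * m ≡ x + n * m + m
      ring = solve-∀
  periodic-*N f per x -[1+ n ] = begin
    f y                                    ≡⟨ ring₁ (f y) (+ suc n * Nℤ) ⟩
    f y + + suc n * Nℤ - + suc n * Nℤ      ≡⟨ cong (_- + suc n * Nℤ) (sym (periodic-*N f per y (+ suc n))) ⟩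
    f (y + + suc n * Nℤ) - + suc n * Nℤ    ≡⟨ cong (λ z → f z - + suc n * Nℤ) (ring₂ x (+ suc n) Nℤ) ⟩
    f x - + suc n * Nℤ                     ≡⟨ ring₃ (f x) (+ suc n) Nℤ ⟩
    f x + -[1+ n ] * Nℤ                    ∎
    where
    open ≡-Reasoning
    y = x + -[1+ n ] * Nℤ
    ring₁ : ∀ a b → a ≡ a + b - b
    ring₁ = solve-∀
    ring₂ : ∀ x n m → x + - n * m + n * m ≡ x
    ring₂ = solve-∀
    ring₃ : ∀ a n m → a - n * m ≡ a + - n * m
    ring₃ = solve-∀

  _≡ₙ_ : ℤ → ℤ → Set
  a ≡ₙ b = a %ℕ N ≡ b %ℕ N

  _≡ₙ?_ : ∀ a b → Dec (a ≡ₙ b)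
  a ≡ₙ? b = a %ℕ N ℕ.≟ b %ℕ N

  %ℕ-+*N : ∀ x t → (x + t * Nℤ) %ℕ N ≡ x %ℕ N
  %ℕ-+*N x t with divMod x
  ... | r , q , r<N , refl =
    trans (cong (_%ℕ N) (ring (+ r) q t Nℤ)) (trans (%ℕ-of-divMod r (q + t) r<N) (sym (%ℕ-of-divMod r q r<N)))
    where
    ring : ∀ r q t n → r + q * n + t * n ≡ r + (q + t) * n
    ring = solve-∀

  multiple⇒≡ₙ : ∀ {a b} t → b ≡ a + t * Nℤ → a ≡ₙ b
  multiple⇒≡ₙ {a} t refl = sym (%ℕ-+*N a t)

  ≡ₙ⇒multiple : ∀ x y → x ≡ₙ y → ∃ λ t → y ≡ x + t * Nℤ
  ≡ₙ⇒multiple x y x≡ₙy with divMod x | divMod y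
  ... | r , q , r<N , refl | r' , q' , r'<N , refl =
    q' - q , trans (cong (λ z → + z + q' * Nℤ) (sym r≡r')) (ring (+ r) q q' Nℤ)
    where
    r≡r' : r ≡ r'
    r≡r' = trans (sym (%ℕ-of-divMod r q r<N)) (trans x≡ₙy (%ℕ-of-divMod r' q' r'<N))
    ring : ∀ r q q' n → r + q' * n ≡ r + q * n + (q' - q) * n
    ring = solve-∀

  %ℕ-suc : ∀ x → (x + + 1) %ℕ N ≡ suc (x %ℕ N) ℕ.% N
  %ℕ-suc x with divMod x
  ... | r , q , r<N , refl with suc r ℕ.<? N
  ...   | yes 1+r<N = begin
    (+ r + q * Nℤ + + 1) %ℕ N       ≡⟨ cong (_%ℕ N) (ring (+ r) q Nℤ) ⟩
    (+ suc r + q * Nℤ) %ℕ N         ≡⟨ %ℕ-of-divMod (suc r) q 1+r<N ⟩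
    suc r                           ≡⟨ sym (ℕD.m<n⇒m%n≡m 1+r<N) ⟩
    suc r ℕ.% N                     ≡⟨ cong (λ z → suc z ℕ.% N) (sym (%ℕ-of-divMod r q r<N)) ⟩
    suc ((+ r + q * Nℤ) %ℕ N) ℕ.% N ∎
    where
    open ≡-Reasoning
    ring : ∀ r q n → r + q * n + + 1 ≡ + 1 + r + q * n
    ring = solve-∀
  ...   | no 1+r≮N with ℕP.≤-antisym r<N (ℕP.≮⇒≥ 1+r≮N)
  ...     | 1+r≡N = begin
    (+ r + q * Nℤ + + 1) %ℕ N       ≡⟨ cong (_%ℕ N) wraps ⟩
    (+ 0 + (q + + 1) * Nℤ) %ℕ N     ≡⟨ %ℕ-of-divMod 0 (q + + 1) (s≤s z≤n) ⟩
    0                               ≡⟨ sym (ℕD.n%n≡0 N) ⟩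
    N ℕ.% N                         ≡⟨ cong (ℕ._% N) (sym 1+r≡N) ⟩
    suc r ℕ.% N                     ≡⟨ cong (λ z → suc z ℕ.% N) (sym (%ℕ-of-divMod r q r<N)) ⟩
    suc ((+ r + q * Nℤ) %ℕ N) ℕ.% N ∎
    where
    open ≡-Reasoning
    ring : ∀ r q n → r + q * n + + 1 ≡ + 0 + (q + + 1) * n + (+ 1 + r - n)
    ring = solve-∀
    wraps : + r + q * Nℤ + + 1 ≡ + 0 + (q + + 1) * Nℤ
    wraps = trans (ring (+ r) q Nℤ)
                  (trans (cong (λ z → + 0 + (q + + 1) * Nℤ + z) (trans (cong (λ z → + z - Nℤ) 1+r≡N) (n⊖n≡0 N)))
                         (+-identityʳ _))

  ≡ₙ-suc : ∀ a b → a ≡ₙ b → (a + + 1) ≡ₙ (b + + 1)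
  ≡ₙ-suc a b a≡ₙb = trans (%ℕ-suc a) (trans (cong (λ z → suc z ℕ.% N) a≡ₙb) (sym (%ℕ-suc b)))

  ≡ₙ-pred : ∀ a b → (a + + 1) ≡ₙ (b + + 1) → a ≡ₙ b
  ≡ₙ-pred a b e with ≡ₙ⇒multiple (a + + 1) (b + + 1) e
  ... | t , e₂ = multiple⇒≡ₙ {a} t (trans (ring₁ b) (trans (cong (_- + 1) e₂) (ring₂ a t Nℤ)))
    where
    ring₁ : ∀ b → b ≡ b + + 1 - + 1
    ring₁ = solve-∀
    ring₂ : ∀ a t n → a + + 1 + t * n - + 1 ≡ a + t * n
    ring₂ = solve-∀

  window-position : ∀ x → + 1 ≤ x → x ≤ Nℤ → ∃ λ c → 1 ℕ.≤ c × c ℕ.≤ N × + c ≡ x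
  window-position x 1≤x x≤N = ∣ x ∣ , +≤+⁻¹ (subst (+ 1 ≤_) (sym c≡x) 1≤x) , +≤+⁻¹ (subst (_≤ Nℤ) (sym c≡x) x≤N) , c≡x
    where
    c≡x : + ∣ x ∣ ≡ x
    c≡x = 0≤i⇒+∣i∣≡i (≤-trans (+≤+ z≤n) 1≤x)

  shift-into-window : ∀ p p' → p < p' → ∃ λ t → + 1 ≤ p + t * Nℤ × p + t * Nℤ ≤ Nℤ × p + t * Nℤ < p' + t * Nℤ
  shift-into-window p p' p<p' with windowDecomp p
  ... | i , q , 1≤i , i≤N , refl =
    - q , subst (+ 1 ≤_) (sym (ring (+ i) q Nℤ)) (+≤+ 1≤i) , subst (_≤ Nℤ) (sym (ring (+ i) q Nℤ)) (+≤+ i≤N) ,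
    +-monoˡ-< ((- q) * Nℤ) p<p'
    where
    ring : ∀ i q n → i + q * n + (- q) * n ≡ i
    ring = solve-∀

  window-shift≡0 : ∀ x t → + 1 ≤ x → x ≤ Nℤ → + 1 ≤ x + t * Nℤ → x + t * Nℤ ≤ Nℤ → t ≡ + 0
  window-shift≡0 x t 1≤x x≤N 1≤x+tN x+tN≤N with <-cmp t (+ 0)
  ... | tri≈ _ t≡0 _ = t≡0
  ... | tri< t<0 _ _ = ⊥-elim (<-irrefl refl (≤-<-trans 1≤x+tN (begin-strict
    x + t * Nℤ       ≤⟨ +-monoˡ-≤ (t * Nℤ) x≤N ⟩
    Nℤ + t * Nℤ      ≡⟨ +-comm Nℤ (t * Nℤ) ⟩
    t * Nℤ + Nℤ      ≤⟨ *N-step t<0 ⟩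
    + 0 * Nℤ         ≡⟨ *-zeroˡ Nℤ ⟩
    + 0              <⟨ +<+ (s≤s z≤n) ⟩
    + 1              ∎)))
    where open ≤-Reasoning
  ... | tri> _ _ t>0 = ⊥-elim (<-irrefl refl (≤-<-trans x+tN≤N (begin-strict
    Nℤ               ≡⟨ sym (+-identityˡ Nℤ) ⟩
    + 0 + Nℤ         ≡⟨ cong (_+ Nℤ) (sym (*-zeroˡ Nℤ)) ⟩
    + 0 * Nℤ + Nℤ    ≤⟨ *N-step t>0 ⟩
    t * Nℤ           <⟨ gap⇒< 0 (+-comm (+ 1) (t * Nℤ)) ⟩
    + 1 + t * Nℤ     ≤⟨ +-monoˡ-≤ (t * Nℤ) 1≤x ⟩
    x + t * Nℤ       ∎)))
    where open ≤-Reasoning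

  -- w = ⌊d / N⌋ and N does not divide d.
  record StrictFloor (d w : ℤ) : Set where
    constructor strictFloor
    field
      lower : w * Nℤ < d
      upper : d < w * Nℤ + Nℤ

  module _ {d w : ℤ} (fl : StrictFloor d w) where
    open StrictFloor fl

    floor-below : ∀ {t} → t ≤ w → t * Nℤ < d
    floor-below t≤w = ≤-<-trans (*N-mono-≤ t≤w) lower

    floor-above : ∀ {t} → w < t → d < t * Nℤ
    floor-above w<t = <-≤-trans upper (*N-step w<t)

    floor-maximal : ∀ {t} → t * Nℤ < d → t ≤ w
    floor-maximal {t} tN<d with t ≤? w
    ... | yes t≤w = t≤w
    ... | no t≰w = ⊥-elim (<-asym tN<d (floor-above (≰⇒> t≰w)))

    floor-minimal : ∀ {t} → d < t * Nℤ → w < t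
    floor-minimal {t} d<tN with w <? t
    ... | yes w<t = w<t
    ... | no w≮t = ⊥-elim (<-asym d<tN (floor-below (≮⇒≥ w≮t)))

    floor-nonMultiple : ∀ t → d ≢ t * Nℤ
    floor-nonMultiple t d≡tN with t ≤? w
    ... | yes t≤w = <-irrefl (sym d≡tN) (floor-below t≤w)
    ... | no t≰w = <-irrefl d≡tN (floor-above (≰⇒> t≰w))

    floor-suc : d + + 1 ≢ (w + + 1) * Nℤ → StrictFloor (d + + 1) w
    floor-suc d+1≢ = strictFloor (<-trans lower (i<i+1 d)) (≤∧≢⇒< d+1≤ (λ e → d+1≢ (trans e (ring w Nℤ))))
      where
      ring : ∀ w n → w * n + n ≡ (w + + 1) * n
      ring = solve-∀
      d+1≤ : d + + 1 ≤ w * Nℤ + Nℤ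
      d+1≤ = subst (_≤ w * Nℤ + Nℤ) (+-comm (+ 1) d) (i<j⇒suc[i]≤j upper)

    floor-pred : d - + 1 ≢ w * Nℤ → StrictFloor (d - + 1) w
    floor-pred d-1≢ = strictFloor
      (≤∧≢⇒< (≤-resp-difference (w * Nℤ) (d - + 1) (i<j⇒suc[i]≤j lower) (ring₁ (w * Nℤ) d)) (λ e → d-1≢ (sym e)))
      (<-trans (<-resp-difference (d - + 1) d (i<i+1 (+ 0)) (ring₂ d)) upper)
      where
      ring₁ : ∀ x d → x - (d - + 1) ≡ + 1 + x - d
      ring₁ = solve-∀
      ring₂ : ∀ d → d - + 1 - d ≡ + 0 - + 1
      ring₂ = solve-∀

  FloorTable : (ℕ → ℤ) → (ℕ → ℕ → ℕ) → Set
  FloorTable a v = ∀ i j → 1 ℕ.≤ i → i ℕ.< j → j ℕ.≤ N → StrictFloor (a j - a i) (+ v i j)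

  module _ (a : ℕ → ℤ) (v : ℕ → ℕ → ℕ) (table : FloorTable a v) where

    floorTable-residues-distinct : ∀ i j → 1 ℕ.≤ i → i ℕ.≤ N → 1 ℕ.≤ j → j ℕ.≤ N → i ≢ j →
                                   ∀ t → a j ≢ a i + t * Nℤ
    floorTable-residues-distinct i j 1≤i i≤N 1≤j j≤N i≢j t e with ℕ.<-cmp i j
    ... | tri< i<j _ _ = floor-nonMultiple (table i j 1≤i i<j j≤N) t (trans (cong (_- a i) e) (ring (a i) (t * Nℤ)))
      where
      ring : ∀ x y → x + y - x ≡ y
      ring = solve-∀
    ... | tri≈ _ i≡j _ = i≢j i≡j
    ... | tri> _ _ j<i = floor-nonMultiple (table j i 1≤j j<i i≤N) (- t)
                           (trans (cong (λ z → a i - z) e) (trans (ring (a i) t Nℤ) (neg-distribˡ-* t Nℤ)))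
      where
      ring : ∀ x t n → x - (x + t * n) ≡ - (t * n)
      ring = solve-∀

    ext-injective : ∀ x y → ext N a x ≡ ext N a y → x ≡ y
    ext-injective x y e with windowDecomp x | windowDecomp y
    ... | i , s , 1≤i , i≤N , refl | j , t , 1≤j , j≤N , refl
      rewrite ext-window a i s 1≤i i≤N | ext-window a j t 1≤j j≤N with i ℕ.≟ j
    ... | yes refl = cong (λ z → + i + z * Nℤ) (*-cancelʳ-≡ s t Nℤ (+-cancelʳ (s * Nℤ) (t * Nℤ) (a i) (trans (+-comm _ (a i)) (trans e (+-comm (a i) _)))))
    ... | no i≢j = ⊥-elim (floorTable-residues-distinct i j 1≤i i≤N 1≤j j≤N i≢j (s - t)
                             (trans (ring₁ (a j) (t * Nℤ)) (trans (cong (_- t * Nℤ) (sym e)) (ring₂ (a i) s t Nℤ))))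
      where
      ring₁ : ∀ x y → x ≡ x + y - y
      ring₁ = solve-∀
      ring₂ : ∀ x s t n → x + s * n - t * n ≡ x + (s - t) * n
      ring₂ = solve-∀

    private
      residue : ℤ → Fin N
      residue x = fromℕ< (n%ℕd<d x N)

      residue⇒≡ₙ : ∀ x y → residue x ≡ residue y → x ≡ₙ y
      residue⇒≡ₙ x y e = trans (sym (FP.toℕ-fromℕ< _)) (trans (cong toℕ e) (FP.toℕ-fromℕ< _))

      windowResidue : Fin N → Fin N
      windowResidue i = residue (a (suc (toℕ i)))

      windowResidue-injective : ∀ i j → windowResidue i ≡ windowResidue j → i ≡ j
      windowResidue-injective i j e with suc (toℕ i) ℕ.≟ suc (toℕ j)
      ... | yes i≡j = FP.toℕ-injective (ℕP.suc-injective i≡j)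
      ... | no i≢j with ≡ₙ⇒multiple (a (suc (toℕ i))) (a (suc (toℕ j))) (residue⇒≡ₙ (a (suc (toℕ i))) (a (suc (toℕ j))) e)
      ...   | t , e₂ = ⊥-elim (floorTable-residues-distinct (suc (toℕ i)) (suc (toℕ j)) (s≤s z≤n) (FP.toℕ<n i) (s≤s z≤n) (FP.toℕ<n j) i≢j t e₂)

    -- The N window values have pairwise distinct residues, so by pigeonhole every residue occurs.
    ext-surjective : ∀ z → ∃ λ x → ext N a x ≡ z
    ext-surjective z with FP.any? (λ i → windowResidue i Fin.≟ residue z)
    ... | yes (i , e) with ≡ₙ⇒multiple (a (suc (toℕ i))) z (residue⇒≡ₙ (a (suc (toℕ i))) z e)
    ...   | t , e₂ = + suc (toℕ i) + t * Nℤ , trans (ext-window a (suc (toℕ i)) t (s≤s z≤n) (FP.toℕ<n i)) (sym e₂)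
    ext-surjective z | no missing
      with FP.pigeonhole (ℕP.n<1+n k) (λ i → punchOut {i = residue z} {j = windowResidue i} (λ e → missing (i , sym e)))
    ... | i , j , i<j , e = ⊥-elim (ℕP.<-irrefl (cong toℕ (windowResidue-injective i j
          (FP.punchOut-injective {i = residue z} (λ e → missing (i , sym e)) (λ e → missing (j , sym e)) e))) i<j)

    inversion⇒floor : ∀ c r t → 1 ℕ.≤ c → c ℕ.≤ N → 1 ℕ.≤ r → r ℕ.≤ N →
                      Inv N (ext N a) (+ c , + r + t * Nℤ) → r ℕ.< c × + 1 ≤ t × t ≤ + v r c
    inversion⇒floor c r t 1≤c c≤N 1≤r r≤N (_ , _ , c<r+tN , inv)
      rewrite ext-window a r t 1≤r r≤N | ext-pos a c 1≤c c≤N with ℕ.<-cmp r c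
    ... | tri< r<c _ _ = r<c , 1≤t , t≤v
      where
      ring : ∀ t ac ar n → t * n - (ac - ar) ≡ ar + t * n - ac
      ring = solve-∀
      t≤v : t ≤ + v r c
      t≤v = floor-maximal (table r c 1≤r r<c c≤N) (<-resp-difference (t * Nℤ) (a c - a r) inv (ring t (a c) (a r) Nℤ))
      1≤t : + 1 ≤ t
      1≤t with + 1 ≤? t
      ... | yes 1≤t = 1≤t
      ... | no 1≰t = ⊥-elim (<-asym c<r+tN (begin-strict
        + r + t * Nℤ   ≤⟨ +-monoʳ-≤ (+ r) (≤-trans (*N-mono-≤ (i<j⇒i≤pred[j] (≰⇒> 1≰t))) (≤-reflexive (*-zeroˡ Nℤ))) ⟩
        + r + + 0      ≡⟨ +-identityʳ (+ r) ⟩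
        + r            <⟨ +<+ r<c ⟩
        + c            ∎))
        where open ≤-Reasoning
    ... | tri≈ _ refl _ = ⊥-elim (<-asym (<-resp-difference (+ 0) (t * Nℤ) c<r+tN (ring₁ (+ c) t Nℤ))
                                         (<-resp-difference (t * Nℤ) (+ 0) inv (ring₂ (a c) t Nℤ)))
      where
      ring₁ : ∀ c t n → + 0 - t * n ≡ c - (c + t * n)
      ring₁ = solve-∀
      ring₂ : ∀ ac t n → t * n - + 0 ≡ ac + t * n - ac
      ring₂ = solve-∀
    ... | tri> _ _ c<r = ⊥-elim (<-asym c<r+tN r+tN<c)
      where
      ring₁ : ∀ ar ac t n → ar - ac - (- t) * n ≡ ar + t * n - ac
      ring₁ = solve-∀
      ring₂ : ∀ t → t - + 0 ≡ + 0 - (- t)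
      ring₂ = solve-∀
      v<-t : + v c r < - t
      v<-t = floor-minimal (table c r 1≤c c<r r≤N) (<-resp-difference (a r - a c) ((- t) * Nℤ) inv (ring₁ (a r) (a c) t Nℤ))
      t<0 : t < + 0
      t<0 = <-resp-difference t (+ 0) (≤-<-trans (+≤+ z≤n) v<-t) (ring₂ t)
      open ≤-Reasoning
      r+tN<c : + r + t * Nℤ < + c
      r+tN<c = begin-strict
        + r + t * Nℤ   ≤⟨ +-monoˡ-≤ (t * Nℤ) (+≤+ r≤N) ⟩
        Nℤ + t * Nℤ    ≡⟨ +-comm Nℤ (t * Nℤ) ⟩
        t * Nℤ + Nℤ    ≤⟨ *N-step t<0 ⟩
        + 0 * Nℤ       ≡⟨ *-zeroˡ Nℤ ⟩
        + 0            <⟨ +<+ 1≤c ⟩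
        + c            ∎

    floor⇒inversion : ∀ r c t → 1 ℕ.≤ r → r ℕ.< c → c ℕ.≤ N → + 1 ≤ t → t ≤ + v r c →
                      Inv N (ext N a) (+ c , + r + t * Nℤ)
    floor⇒inversion r c t 1≤r r<c c≤N 1≤t t≤v = +≤+ (ℕP.≤-trans 1≤r (ℕP.<⇒≤ r<c)) , +≤+ c≤N , c<r+tN , inv
      where
      open ≤-Reasoning
      c<r+tN : + c < + r + t * Nℤ
      c<r+tN = begin-strict
        + c            ≤⟨ +≤+ c≤N ⟩
        Nℤ             ≡⟨ sym (*-identityˡ Nℤ) ⟩
        + 1 * Nℤ       ≤⟨ *N-mono-≤ 1≤t ⟩
        t * Nℤ         <⟨ gap⇒< 0 (+-comm (+ 1) (t * Nℤ)) ⟩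
        + 1 + t * Nℤ   ≤⟨ +-monoˡ-≤ (t * Nℤ) (+≤+ 1≤r) ⟩
        + r + t * Nℤ   ∎
      ring : ∀ t ac ar n → ar + t * n - ac ≡ t * n - (ac - ar)
      ring = solve-∀
      inv : ext N a (+ r + t * Nℤ) < ext N a (+ c)
      inv rewrite ext-window a r t 1≤r (ℕP.≤-trans (ℕP.<⇒≤ r<c) c≤N) | ext-pos a c (ℕP.≤-trans 1≤r (ℕP.<⇒≤ r<c)) c≤N =
        <-resp-difference (a r + t * Nℤ) (a c) (floor-below (table r c 1≤r r<c c≤N) t≤v) (ring t (a c) (a r) Nℤ)

    -- Adding the floor bounds for (i, j) and (j, k) gives (v_ij + v_jk) N < a_k − a_i < (v_ij + v_jk + 2) N.
    floorTable⇒triangle : ∀ i j k → 1 ℕ.≤ i → i ℕ.< j → j ℕ.< k → k ℕ.≤ N →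
                          v i j ℕ.+ v j k ℕ.≤ v i k × v i k ℕ.≤ suc (v i j ℕ.+ v j k)
    floorTable⇒triangle i j k 1≤i i<j j<k k≤N =
      +≤+⁻¹ (floor-maximal ik lowerSum) ,
      ℕP.≤-pred (subst (suc (v i k) ℕ.≤_) (ℕP.+-comm (v i j ℕ.+ v j k) 2) (+<+⁻¹ (floor-minimal ik upperSum)))
      where
      ij = table i j 1≤i i<j (ℕP.≤-trans (ℕP.<⇒≤ j<k) k≤N)
      jk = table j k (ℕP.≤-trans 1≤i (ℕP.<⇒≤ i<j)) j<k k≤N
      ik = table i k 1≤i (ℕP.<-trans i<j j<k) k≤N
      ring₁ : ∀ ak aj ai → ak - ai ≡ (aj - ai) + (ak - aj)
      ring₁ = solve-∀
      ring₂ : ∀ x y n → x * n + y * n ≡ (x + y) * n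
      ring₂ = solve-∀
      ring₃ : ∀ x y n → x * n + n + (y * n + n) ≡ (x + y + + 2) * n
      ring₃ = solve-∀
      lowerSum : (+ v i j + + v j k) * Nℤ < a k - a i
      lowerSum = subst₂ _<_ (ring₂ (+ v i j) (+ v j k) Nℤ) (sym (ring₁ (a k) (a j) (a i)))
                   (+-mono-< (StrictFloor.lower ij) (StrictFloor.lower jk))
      upperSum : a k - a i < (+ v i j + + v j k + + 2) * Nℤ
      upperSum = subst₂ _<_ (sym (ring₁ (a k) (a j) (a i))) (ring₃ (+ v i j) (+ v j k) Nℤ)
                   (+-mono-< (StrictFloor.upper ij) (StrictFloor.upper jk))

  inversions-mono : ∀ a v b w → FloorTable a v → FloorTable b w → v ≤[ N ]T w →
                    ∀ x y → x < y → ext N a y < ext N a x → ext N b y < ext N b x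
  inversions-mono a v b w tableA tableB v≤w x y x<y inv with windowDecomp x | windowDecomp y
  ... | i , s , 1≤i , i≤N , refl | j , t , 1≤j , j≤N , refl
    rewrite ext-window a i s 1≤i i≤N | ext-window a j t 1≤j j≤N | ext-window b i s 1≤i i≤N | ext-window b j t 1≤j j≤N
    with ℕ.<-cmp i j
  ... | tri≈ _ refl _ = ⊥-elim (<-asym (<-resp-difference (s * Nℤ) (t * Nℤ) x<y (ring (+ i) s t Nℤ))
                                       (<-resp-difference (t * Nℤ) (s * Nℤ) inv (ring (a i) t s Nℤ)))
    where
    ring : ∀ i s t n → s * n - t * n ≡ i + s * n - (i + t * n)
    ring = solve-∀
  ... | tri< i<j _ _ = ⊥-elim (<-asym x<y y<x)
    where
    ring₁ : ∀ aj ai t s n → aj - ai - (s - t) * n ≡ aj + t * n - (ai + s * n)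
    ring₁ = solve-∀
    ring₂ : ∀ t s → t - s ≡ + 0 - (s - t)
    ring₂ = solve-∀
    v<s-t : + v i j < s - t
    v<s-t = floor-minimal (tableA i j 1≤i i<j j≤N) (<-resp-difference (a j - a i) ((s - t) * Nℤ) inv (ring₁ (a j) (a i) t s Nℤ))
    t<s : t < s
    t<s = <-resp-difference t s (≤-<-trans (+≤+ z≤n) v<s-t) (ring₂ t s)
    open ≤-Reasoning
    y<x : + j + t * Nℤ < + i + s * Nℤ
    y<x = begin-strict
      + j + t * Nℤ   ≤⟨ +-monoˡ-≤ (t * Nℤ) (+≤+ j≤N) ⟩
      Nℤ + t * Nℤ    ≡⟨ +-comm Nℤ (t * Nℤ) ⟩
      t * Nℤ + Nℤ    ≤⟨ *N-step t<s ⟩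
      s * Nℤ         <⟨ gap⇒< 0 (sym (+-comm (s * Nℤ) (+ 1))) ⟩
      + 1 + s * Nℤ   ≤⟨ +-monoˡ-≤ (s * Nℤ) (+≤+ 1≤i) ⟩
      + i + s * Nℤ   ∎
  ... | tri> _ _ j<i = <-resp-difference (b j + t * Nℤ) (b i + s * Nℤ)
                         (floor-below (tableB j i 1≤j j<i i≤N) (≤-trans t-s≤v (+≤+ (v≤w j i (1≤j , j<i , i≤N)))))
                         (ring (b j) (b i) t s Nℤ)
    where
    ring : ∀ aj ai t s n → aj + t * n - (ai + s * n) ≡ (t - s) * n - (ai - aj)
    ring = solve-∀
    t-s≤v : t - s ≤ + v j i
    t-s≤v = floor-maximal (tableA j i 1≤j j<i i≤N) (<-resp-difference ((t - s) * Nℤ) (a i - a j) inv (sym (ring (a j) (a i) t s Nℤ)))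

  -- ψ v i p is the contribution of position p to the window entry a_i.
  ψ : (ℕ → ℕ → ℕ) → ℕ → ℕ → ℤ
  ψ v i p with ℕ.<-cmp p i
  ... | tri< _ _ _ = + v p i + + 1
  ... | tri≈ _ _ _ = + 1
  ... | tri> _ _ _ = - + v i p

  ψ-< : ∀ v i p → p ℕ.< i → ψ v i p ≡ + v p i + + 1
  ψ-< v i p p<i with ℕ.<-cmp p i
  ... | tri< _ _ _ = refl
  ... | tri≈ p≮i _ _ = ⊥-elim (p≮i p<i)
  ... | tri> p≮i _ _ = ⊥-elim (p≮i p<i)

  ψ-≡ : ∀ v i → ψ v i i ≡ + 1
  ψ-≡ v i with ℕ.<-cmp i i
  ... | tri< _ i≢i _ = ⊥-elim (i≢i refl)
  ... | tri≈ _ _ _ = refl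
  ... | tri> _ i≢i _ = ⊥-elim (i≢i refl)

  ψ-> : ∀ v i p → i ℕ.< p → ψ v i p ≡ - + v i p
  ψ-> v i p i<p with ℕ.<-cmp p i
  ... | tri< _ _ p≯i = ⊥-elim (p≯i i<p)
  ... | tri≈ _ _ p≯i = ⊥-elim (p≯i i<p)
  ... | tri> _ _ _ = refl

  ψ-sym : ∀ v i p → p ≢ i → ψ v i p + ψ v p i ≡ + 1
  ψ-sym v i p p≢i = go (ℕ.<-cmp p i)
    where
    ring₁ : ∀ x → x + + 1 + - x ≡ + 1
    ring₁ = solve-∀
    ring₂ : ∀ x → - x + (x + + 1) ≡ + 1
    ring₂ = solve-∀
    go : Tri (p ℕ.< i) (p ≡ i) (i ℕ.< p) → ψ v i p + ψ v p i ≡ + 1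
    go (tri< p<i _ _) = trans (cong₂ _+_ (ψ-< v i p p<i) (ψ-> v p i p<i)) (ring₁ (+ v p i))
    go (tri≈ _ p≡i _) = ⊥-elim (p≢i p≡i)
    go (tri> _ _ i<p) = trans (cong₂ _+_ (ψ-> v i p i<p) (ψ-< v p i i<p)) (ring₂ (+ v i p))

  Fwin≡sumψ : ∀ v i → 1 ℕ.≤ i → i ℕ.≤ N → Fwin N v i ≡ sumToℤ N (ψ v i)
  Fwin≡sumψ v (suc i') _ i≤N = sym (begin
    sumToℤ N (ψ v i)
      ≡⟨ cong (λ z → sumToℤ z (ψ v i)) (sym (ℕP.m+[n∸m]≡n i≤N)) ⟩
    sumToℤ (i ℕ.+ r) (ψ v i)
      ≡⟨ sumToℤ-split i r (ψ v i) ⟩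
    sumToℤ i' (ψ v i) + ψ v i i + sumToℤ r (λ t → ψ v i (i ℕ.+ t))
      ≡⟨ cong₂ (λ x y → x + ψ v i i + y) below above ⟩
    sumToℤ i' (λ p → + v p i + + 1) + ψ v i i + sumToℤ r (λ t → - + v i (i ℕ.+ t))
      ≡⟨ cong₂ (λ x y → x + y + sumToℤ r (λ t → - + v i (i ℕ.+ t))) (sumToℤ-+ i' _ _) (ψ-≡ v i) ⟩
    sumToℤ i' (λ p → + v p i) + sumToℤ i' (λ _ → + 1) + + 1 + sumToℤ r (λ t → - + v i (i ℕ.+ t))
      ≡⟨ cong₂ (λ x y → sumToℤ i' (λ p → + v p i) + x + + 1 + y) (sumToℤ-const i' (+ 1)) (sumToℤ-neg r _) ⟩
    sumToℤ i' (λ p → + v p i) + + 1 * + i' + + 1 + - sumToℤ r (λ t → + v i (i ℕ.+ t))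
      ≡⟨ cong₂ (λ x y → x + + 1 * + i' + + 1 + - y) (sym (+-sumTo i' _)) (sym (+-sumTo r _)) ⟩
    + sumTo i' (λ p → v p i) + + 1 * + i' + + 1 + - + sumTo r (λ t → v i (i ℕ.+ t))
      ≡⟨ ring (+ sumTo i' (λ p → v p i)) (+ i') (+ sumTo r (λ t → v i (i ℕ.+ t))) ⟩
    Fwin N v i ∎)
    where
    open ≡-Reasoning
    i = suc i'
    r = N ∸ i
    below : sumToℤ i' (ψ v i) ≡ sumToℤ i' (λ p → + v p i + + 1)
    below = sumToℤ-cong i' _ _ (λ p _ p≤i' → ψ-< v i p (s≤s p≤i'))
    above : sumToℤ r (λ t → ψ v i (i ℕ.+ t)) ≡ sumToℤ r (λ t → - + v i (i ℕ.+ t))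
    above = sumToℤ-cong r _ _ (λ t 1≤t _ → ψ-> v i (i ℕ.+ t) (ℕP.m<m+n i 1≤t))
    ring : ∀ a b c → a + + 1 * b + + 1 + - c ≡ (+ 1 + b + a) - c
    ring = solve-∀

  ψ-diff : (ℕ → ℕ → ℕ) → ℕ → ℕ → ℕ → ℤ
  ψ-diff v i j p = ψ v j p - ψ v i p

  ψ-diff-at-i : ∀ v i j → i ℕ.< j → ψ-diff v i j i ≡ + v i j
  ψ-diff-at-i v i j i<j = trans (cong₂ _-_ (ψ-< v j i i<j) (ψ-≡ v i)) (ring (+ v i j))
    where
    ring : ∀ x → x + + 1 - + 1 ≡ x
    ring = solve-∀

  ψ-diff-at-j : ∀ v i j → i ℕ.< j → ψ-diff v i j j ≡ + v i j + + 1
  ψ-diff-at-j v i j i<j = trans (cong₂ _-_ (ψ-≡ v j) (ψ-> v i j i<j)) (ring (+ v i j))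
    where
    ring : ∀ x → + 1 - (- x) ≡ x + + 1
    ring = solve-∀

  Between : ℤ → ℤ → Set
  Between x z = x ≤ z × z ≤ x + + 1

  private
    gap≤1 : ∀ x c → x ℕ.≤ c → c ℕ.≤ suc x → ∃ λ d → d ℕ.≤ 1 × c ≡ x ℕ.+ d
    gap≤1 x c x≤c c≤1+x = c ∸ x ,
      ℕP.+-cancelˡ-≤ x _ _ (subst (ℕ._≤ x ℕ.+ 1) (sym (ℕP.m+[n∸m]≡n x≤c)) (subst (c ℕ.≤_) (sym (ℕP.+-comm x 1)) c≤1+x)) ,
      sym (ℕP.m+[n∸m]≡n x≤c)

    triangle⇒between-diff : ∀ a b c → a ℕ.+ b ℕ.≤ c → c ℕ.≤ suc (a ℕ.+ b) → Between (+ b) (+ c - + a)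
    triangle⇒between-diff a b c lower upper with gap≤1 (a ℕ.+ b) c lower upper
    ... | d , d≤1 , refl = subst (+ b ≤_) (sym c-a≡b+d) (i≤i+j (+ b) (+ d)) , subst (_≤ + b + + 1) (sym c-a≡b+d) (+-monoʳ-≤ (+ b) (+≤+ d≤1))
      where
      ring : ∀ a b d → a + b + d - a ≡ b + d
      ring = solve-∀
      c-a≡b+d : + (a ℕ.+ b ℕ.+ d) - + a ≡ + b + + d
      c-a≡b+d = trans (cong (_- + a) (trans (pos-+ (a ℕ.+ b) d) (cong (_+ + d) (pos-+ a b)))) (ring (+ a) (+ b) (+ d))

    triangle⇒between-sum : ∀ a b c → a ℕ.+ b ℕ.≤ c → c ℕ.≤ suc (a ℕ.+ b) → Between (+ c) (+ a + + b + + 1)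
    triangle⇒between-sum a b c lower upper with gap≤1 (a ℕ.+ b) c lower upper
    ... | d , d≤1 , refl =
      subst (_≤ + a + + b + + 1) (sym c≡a+b+d) (+-monoʳ-≤ (+ a + + b) (+≤+ d≤1)) ,
      subst (+ a + + b + + 1 ≤_) (sym (cong (_+ + 1) c≡a+b+d)) (+-monoˡ-≤ (+ 1) (i≤i+j (+ a + + b) (+ d)))
      where
      c≡a+b+d : + (a ℕ.+ b ℕ.+ d) ≡ + a + + b + + d
      c≡a+b+d = trans (pos-+ (a ℕ.+ b) d) (cong (_+ + d) (pos-+ a b))

  -- Each ψ-difference is pinned by the triangle inequality for the triple formed by i, j, p.
  ψ-diff-between : ∀ v → Admitted N v → ∀ i j p → 1 ℕ.≤ i → i ℕ.< j → j ℕ.≤ N → 1 ℕ.≤ p → p ℕ.≤ N →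
                   Between (+ v i j) (ψ-diff v i j p)
  ψ-diff-between v (_ , triangle) i j p 1≤i i<j j≤N 1≤p p≤N = go (ℕ.<-cmp p i) (ℕ.<-cmp p j)
    where
    go : Tri (p ℕ.< i) (p ≡ i) (i ℕ.< p) → Tri (p ℕ.< j) (p ≡ j) (j ℕ.< p) → Between (+ v i j) (ψ-diff v i j p)
    go (tri< p<i _ _) _ = subst (Between (+ v i j)) (sym diff) (triangle⇒between-diff (v p i) (v i j) (v p j) (proj₁ t) (proj₂ t))
      where
      t = triangle p i j 1≤p p<i i<j j≤N
      ring : ∀ x y → x + + 1 - (y + + 1) ≡ x - y
      ring = solve-∀
      diff : ψ-diff v i j p ≡ + v p j - + v p i
      diff = trans (cong₂ _-_ (ψ-< v j p (ℕP.<-trans p<i i<j)) (ψ-< v i p p<i)) (ring (+ v p j) (+ v p i))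
    go (tri≈ _ refl _) _ = subst (Between (+ v i j)) (sym (ψ-diff-at-i v i j i<j)) (ℤP.≤-refl , i≤i+j _ (+ 1))
    go (tri> _ _ i<p) (tri< p<j _ _) = subst (Between (+ v i j)) (sym diff) (triangle⇒between-sum (v i p) (v p j) (v i j) (proj₁ t) (proj₂ t))
      where
      t = triangle i p j 1≤i i<p p<j j≤N
      ring : ∀ x y → x + + 1 - (- y) ≡ y + x + + 1
      ring = solve-∀
      diff : ψ-diff v i j p ≡ + v i p + + v p j + + 1
      diff = trans (cong₂ _-_ (ψ-< v j p p<j) (ψ-> v i p i<p)) (ring (+ v p j) (+ v i p))
    go (tri> _ _ i<p) (tri≈ _ refl _) = subst (Between (+ v i j)) (sym (ψ-diff-at-j v i j i<j)) (i≤i+j _ (+ 1) , ℤP.≤-refl)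
    go (tri> _ _ i<p) (tri> _ _ j<p) =
      subst (Between (+ v i j)) (sym diff) (triangle⇒between-diff (v j p) (v i j) (v i p)
        (subst (ℕ._≤ v i p) (ℕP.+-comm (v i j) (v j p)) (proj₁ t)) (subst (λ z → v i p ℕ.≤ suc z) (ℕP.+-comm (v i j) (v j p)) (proj₂ t)))
      where
      t = triangle i j p 1≤i i<j j<p p≤N
      ring : ∀ x y → - y - (- x) ≡ x - y
      ring = solve-∀
      diff : ψ-diff v i j p ≡ + v i p - + v j p
      diff = trans (cong₂ _-_ (ψ-> v j p j<p) (ψ-> v i p (ℕP.<-trans i<j j<p))) (ring (+ v i p) (+ v j p))

  Fwin-diff≡sumψ-diff : ∀ v i j → 1 ℕ.≤ i → i ℕ.< j → j ℕ.≤ N → Fwin N v j - Fwin N v i ≡ sumToℤ N (ψ-diff v i j)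
  Fwin-diff≡sumψ-diff v i j 1≤i i<j j≤N =
    trans (cong₂ _-_ (Fwin≡sumψ v j (ℕP.≤-trans 1≤i (ℕP.<⇒≤ i<j)) j≤N) (Fwin≡sumψ v i 1≤i (ℕP.≤-trans (ℕP.<⇒≤ i<j) j≤N)))
          (sym (trans (sumToℤ-+ N (ψ v j) (λ p → - ψ v i p)) (cong (λ z → sumToℤ N (ψ v j) + z) (sumToℤ-neg N (ψ v i)))))

  -- The N terms of a_j − a_i lie in {v_ij, v_ij + 1}; the term at j is v_ij + 1 and the term at i is v_ij.
  Fwin-floorTable : ∀ v → Admitted N v → FloorTable (Fwin N v) v
  Fwin-floorTable v adm i j 1≤i i<j j≤N = strictFloor (subst (+ v i j * Nℤ <_) (sym diff) lower) (subst (_< + v i j * Nℤ + Nℤ) (sym diff) upper)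
    where
    diff : Fwin N v j - Fwin N v i ≡ sumToℤ N (ψ-diff v i j)
    diff = Fwin-diff≡sumψ-diff v i j 1≤i i<j j≤N
    bounds : ∀ p → 1 ℕ.≤ p → p ℕ.≤ N → Between (+ v i j) (ψ-diff v i j p)
    bounds p 1≤p p≤N = ψ-diff-between v adm i j p 1≤i i<j j≤N 1≤p p≤N
    ring : ∀ x n → (x + + 1) * n ≡ x * n + n
    ring = solve-∀
    lower : + v i j * Nℤ < sumToℤ N (ψ-diff v i j)
    lower = subst (_< sumToℤ N (ψ-diff v i j)) (sumToℤ-const N (+ v i j))
      (sumToℤ-mono-< N (λ _ → + v i j) (ψ-diff v i j) (λ p 1≤p p≤N → proj₁ (bounds p 1≤p p≤N))
        j (ℕP.≤-trans 1≤i (ℕP.<⇒≤ i<j)) j≤N (subst (+ v i j <_) (sym (ψ-diff-at-j v i j i<j)) (i<i+1 _)))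
    upper : sumToℤ N (ψ-diff v i j) < + v i j * Nℤ + Nℤ
    upper = subst (sumToℤ N (ψ-diff v i j) <_) (trans (sumToℤ-const N (+ v i j + + 1)) (ring (+ v i j) Nℤ))
      (sumToℤ-mono-< N (ψ-diff v i j) (λ _ → + v i j + + 1) (λ p 1≤p p≤N → proj₂ (bounds p 1≤p p≤N))
        i 1≤i (ℕP.≤-trans (ℕP.<⇒≤ i<j) j≤N) (subst (_< + v i j + + 1) (sym (ψ-diff-at-i v i j i<j)) (i<i+1 _)))

  Fwin-cong : ∀ v w → (∀ i j → InT N i j → v i j ≡ w i j) → ∀ i → 1 ℕ.≤ i → i ℕ.≤ N → Fwin N v i ≡ Fwin N w i
  Fwin-cong v w v≗w i 1≤i i≤N = cong₂ (λ x y → (+ i + + x) - + y)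
    (sumTo-cong (i ∸ 1) _ _ (λ p 1≤p p≤i-1 → v≗w p i (1≤p , ≤pred⇒< i 1≤i p≤i-1 , i≤N)))
    (sumTo-cong (N ∸ i) _ _ (λ t 1≤t t≤N-i → v≗w i (i ℕ.+ t)
      (1≤i , ℕP.m<m+n i 1≤t , subst (i ℕ.+ t ℕ.≤_) (ℕP.m+[n∸m]≡n i≤N) (ℕP.+-monoʳ-≤ i t≤N-i))))
    where
    ≤pred⇒< : ∀ {p} i → 1 ℕ.≤ i → p ℕ.≤ i ∸ 1 → p ℕ.< i
    ≤pred⇒< (suc _) _ p≤i-1 = s≤s p≤i-1

  -- 2 Σ a_i = Σ_i Σ_p (ψ v i p + ψ v p i), and for p ≠ i the inner term is 1 by antisymmetry of ψ.
  Fwin-sum : ∀ v → + 2 * sumToℤ N (λ i → Fwin N v i) ≡ + (N ℕ.* suc N)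
  Fwin-sum v = begin
    + 2 * sumToℤ N (λ i → Fwin N v i)
      ≡⟨ cong (+ 2 *_) (sumToℤ-cong N _ _ (λ i 1≤i i≤N → Fwin≡sumψ v i 1≤i i≤N)) ⟩
    + 2 * S
      ≡⟨ ring₁ S ⟩
    S + S
      ≡⟨ cong (λ z → S + z) (sumToℤ-swap N N (λ i p → ψ v i p)) ⟩
    S + sumToℤ N (λ i → sumToℤ N (λ p → ψ v p i))
      ≡⟨ sym (sumToℤ-+ N _ _) ⟩
    sumToℤ N (λ i → sumToℤ N (λ p → ψ v i p) + sumToℤ N (λ p → ψ v p i))
      ≡⟨ sumToℤ-cong N _ _ (λ i 1≤i i≤N → trans (sym (sumToℤ-+ N _ _)) (row i 1≤i i≤N)) ⟩
    sumToℤ N (λ _ → + 1 * Nℤ + + 1)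
      ≡⟨ sumToℤ-const N _ ⟩
    (+ 1 * Nℤ + + 1) * Nℤ
      ≡⟨ ring₂ Nℤ ⟩
    Nℤ * (+ 1 + Nℤ)
      ≡⟨ sym (pos-* N (suc N)) ⟩
    + (N ℕ.* suc N) ∎
    where
    open ≡-Reasoning
    S = sumToℤ N (λ i → sumToℤ N (λ p → ψ v i p))
    ring₁ : ∀ x → + 2 * x ≡ x + x
    ring₁ = solve-∀
    ring₂ : ∀ n → (+ 1 * n + + 1) * n ≡ n * (+ 1 + n)
    ring₂ = solve-∀
    row : ∀ i → 1 ℕ.≤ i → i ℕ.≤ N → sumToℤ N (λ p → ψ v i p + ψ v p i) ≡ + 1 * Nℤ + + 1
    row i 1≤i i≤N = trans (sumToℤ-bump N (λ _ → + 1) (λ p → ψ v i p + ψ v p i) i (+ 1) 1≤i i≤N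
                            (cong₂ _+_ (ψ-≡ v i) (ψ-≡ v i)) (λ p p≢i → ψ-sym v i p p≢i))
                          (cong (_+ + 1) (sumToℤ-const N (+ 1)))

  v₀ : ℕ → ℕ → ℕ
  v₀ _ _ = 0

  v₀-admitted : Admitted N v₀
  v₀-admitted = (λ _ _ _ → refl) , (λ _ _ _ _ _ _ _ → z≤n , z≤n)

  ext-Fwin-v₀ : ∀ x → ext N (Fwin N v₀) x ≡ x
  ext-Fwin-v₀ x = trans (ext-cong (Fwin N v₀) +_ Fwin-v₀ x) (ext-id x)
    where
    ring : ∀ x → x + + 0 - + 0 ≡ x
    ring = solve-∀
    Fwin-v₀ : ∀ i → 1 ℕ.≤ i → i ℕ.≤ N → Fwin N v₀ i ≡ + i
    Fwin-v₀ i _ _ = trans (cong₂ (λ x y → (+ i + + x) - + y) (sumTo-zero (i ∸ 1)) (sumTo-zero (N ∸ i))) (ring (+ i))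

  bump : (ℕ → ℕ → ℕ) → ℕ → ℕ → ℕ → ℕ → ℕ
  bump v r c i j with i ℕ.≟ r | j ℕ.≟ c
  ... | yes _ | yes _ = suc (v i j)
  ... | yes _ | no _  = v i j
  ... | no _  | _     = v i j

  bump-at : ∀ v r c → bump v r c r c ≡ suc (v r c)
  bump-at v r c with r ℕ.≟ r | c ℕ.≟ c
  ... | yes _ | yes _  = refl
  ... | yes _ | no c≢c = ⊥-elim (c≢c refl)
  ... | no r≢r | _     = ⊥-elim (r≢r refl)

  bump-elsewhere : ∀ v r c i j → i ≢ r ⊎ j ≢ c → bump v r c i j ≡ v i j
  bump-elsewhere v r c i j elsewhere with i ℕ.≟ r | j ℕ.≟ c
  bump-elsewhere v r c i j (inj₁ i≢r) | yes i≡r | yes _ = ⊥-elim (i≢r i≡r)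
  bump-elsewhere v r c i j (inj₂ j≢c) | yes _ | yes j≡c = ⊥-elim (j≢c j≡c)
  ... | yes _ | no _ = refl
  ... | no _  | _    = refl

  private
    <⇒≤pred : ∀ {r c} → r ℕ.< c → r ℕ.≤ c ∸ 1
    <⇒≤pred {r} {suc c} (s≤s r≤c) = r≤c

  module Bump (v : ℕ → ℕ → ℕ) (r c : ℕ) (1≤r : 1 ℕ.≤ r) (r<c : r ℕ.< c) (c≤N : c ℕ.≤ N) where

    Fwin-bump-c : Fwin N (bump v r c) c ≡ Fwin N v c + + 1
    Fwin-bump-c = trans (cong₂ (λ x y → (+ c + + x) - + y) column row)
                        (ring (+ c) (+ sumTo (c ∸ 1) (λ p → v p c)) (+ sumTo (N ∸ c) (λ t → v c (c ℕ.+ t))))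
      where
      column : sumTo (c ∸ 1) (λ p → bump v r c p c) ≡ suc (sumTo (c ∸ 1) (λ p → v p c))
      column = sumTo-bump (c ∸ 1) (λ p → v p c) (λ p → bump v r c p c) r 1≤r (<⇒≤pred r<c)
                 (bump-at v r c) (λ p p≢r → bump-elsewhere v r c p c (inj₁ p≢r))
      row : sumTo (N ∸ c) (λ t → bump v r c c (c ℕ.+ t)) ≡ sumTo (N ∸ c) (λ t → v c (c ℕ.+ t))
      row = sumTo-cong (N ∸ c) _ _ (λ t _ _ → bump-elsewhere v r c c (c ℕ.+ t) (inj₁ (λ c≡r → ℕP.<-irrefl (sym c≡r) r<c)))
      ring : ∀ c a b → c + (+ 1 + a) - b ≡ c + a - b + + 1
      ring = solve-∀

    Fwin-bump-r : Fwin N (bump v r c) r ≡ Fwin N v r - + 1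
    Fwin-bump-r = trans (cong₂ (λ x y → (+ r + + x) - + y) column row)
                        (ring (+ r) (+ sumTo (r ∸ 1) (λ p → v p r)) (+ sumTo (N ∸ r) (λ t → v r (r ℕ.+ t))))
      where
      column : sumTo (r ∸ 1) (λ p → bump v r c p r) ≡ sumTo (r ∸ 1) (λ p → v p r)
      column = sumTo-cong (r ∸ 1) _ _ (λ p _ _ → bump-elsewhere v r c p r (inj₂ (λ r≡c → ℕP.<-irrefl r≡c r<c)))
      r+d≡c : r ℕ.+ (c ∸ r) ≡ c
      r+d≡c = ℕP.m+[n∸m]≡n (ℕP.<⇒≤ r<c)
      row : sumTo (N ∸ r) (λ t → bump v r c r (r ℕ.+ t)) ≡ suc (sumTo (N ∸ r) (λ t → v r (r ℕ.+ t)))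
      row = sumTo-bump (N ∸ r) (λ t → v r (r ℕ.+ t)) (λ t → bump v r c r (r ℕ.+ t)) (c ∸ r)
              (ℕP.m<n⇒0<n∸m r<c) (ℕP.∸-monoˡ-≤ r c≤N)
              (trans (cong (bump v r c r) r+d≡c) (trans (bump-at v r c) (cong (λ z → suc (v r z)) (sym r+d≡c))))
              (λ t t≢d → bump-elsewhere v r c r (r ℕ.+ t) (inj₂ (λ e → t≢d (ℕP.+-cancelˡ-≡ r t (c ∸ r) (trans e (sym r+d≡c))))))
      ring : ∀ r a b → r + a - (+ 1 + b) ≡ r + a - b - + 1
      ring = solve-∀

    Fwin-bump-other : ∀ i → i ≢ r → i ≢ c → Fwin N (bump v r c) i ≡ Fwin N v i
    Fwin-bump-other i i≢r i≢c = cong₂ (λ x y → (+ i + + x) - + y)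
      (sumTo-cong (i ∸ 1) _ _ (λ p _ _ → bump-elsewhere v r c p i (inj₂ i≢c)))
      (sumTo-cong (N ∸ i) _ _ (λ t _ _ → bump-elsewhere v r c i (i ℕ.+ t) (inj₁ i≢r)))

  total : (ℕ → ℕ → ℕ) → ℕ
  total v = sumTo N (λ j → sumTo (j ∸ 1) (λ i → v i j))

  total-bump : ∀ v r c → 1 ℕ.≤ r → r ℕ.< c → c ℕ.≤ N → total (bump v r c) ≡ suc (total v)
  total-bump v r c 1≤r r<c c≤N =
    sumTo-bump N (λ j → sumTo (j ∸ 1) (λ i → v i j)) (λ j → sumTo (j ∸ 1) (λ i → bump v r c i j)) c (ℕP.≤-trans 1≤r (ℕP.<⇒≤ r<c)) c≤N
      (sumTo-bump (c ∸ 1) (λ p → v p c) (λ p → bump v r c p c) r 1≤r (<⇒≤pred r<c)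
        (bump-at v r c) (λ p p≢r → bump-elsewhere v r c p c (inj₁ p≢r)))
      (λ j j≢c → sumTo-cong (j ∸ 1) _ _ (λ i _ _ → bump-elsewhere v r c i j (inj₂ j≢c)))

  private
    inT-of-column : ∀ i j → 1 ℕ.≤ i → i ℕ.≤ j ∸ 1 → j ℕ.≤ N → InT N i j
    inT-of-column i       (suc j) 1≤i i≤j j≤N = 1≤i , s≤s i≤j , j≤N
    inT-of-column zero    zero    ()  _   _
    inT-of-column (suc i) zero    _   ()  _

  total-mono-≤ : ∀ v w → v ≤[ N ]T w → total v ℕ.≤ total w
  total-mono-≤ v w v≤w =
    sumTo-mono-≤ N _ _ (λ j _ j≤N → sumTo-mono-≤ (j ∸ 1) _ _ (λ i 1≤i i≤j-1 → v≤w i j (inT-of-column i j 1≤i i≤j-1 j≤N)))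

  total-mono-< : ∀ v w → v ≤[ N ]T w → ∀ i j → InT N i j → v i j ℕ.< w i j → total v ℕ.< total w
  total-mono-< v w v≤w i j (1≤i , i<j , j≤N) vij<wij =
    sumTo-mono-< N _ _ (λ j _ j≤N → sumTo-mono-≤ (j ∸ 1) _ _ (λ i 1≤i i≤j-1 → v≤w i j (inT-of-column i j 1≤i i≤j-1 j≤N)))
      j (ℕP.≤-trans 1≤i (ℕP.<⇒≤ i<j)) j≤N
      (sumTo-mono-< (j ∸ 1) _ _ (λ i 1≤i i≤j-1 → v≤w i j (inT-of-column i j 1≤i i≤j-1 j≤N)) i 1≤i (<⇒≤pred i<j) vij<wij)

  ≤T⇒≡T⊎<somewhere : ∀ v w → v ≤[ N ]T w → (∀ i j → InT N i j → v i j ≡ w i j) ⊎ ∃ λ i → ∃ λ j → InT N i j × v i j ℕ.< w i j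
  ≤T⇒≡T⊎<somewhere v w v≤w with allBelow⊎someBelow row (suc N)
    where
    entry : ∀ i j → (InT N i j → v i j ≡ w i j) ⊎ (InT N i j × v i j ℕ.< w i j)
    entry i j with 1 ℕ.≤? i | i ℕ.<? j | j ℕ.≤? N
    ... | yes 1≤i | yes i<j | yes j≤N with v i j ℕ.≟ w i j
    ...   | yes e = inj₁ (λ _ → e)
    ...   | no ne = inj₂ ((1≤i , i<j , j≤N) , ℕP.≤∧≢⇒< (v≤w i j (1≤i , i<j , j≤N)) ne)
    entry i j | no 1≰i | _ | _ = inj₁ (λ t → ⊥-elim (1≰i (proj₁ t)))
    entry i j | yes _ | no i≮j | _ = inj₁ (λ t → ⊥-elim (i≮j (proj₁ (proj₂ t))))
    entry i j | yes _ | yes _ | no j≰N = inj₁ (λ t → ⊥-elim (j≰N (proj₂ (proj₂ t))))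
    row : ∀ i → (∀ j → j ℕ.< suc N → InT N i j → v i j ≡ w i j) ⊎ ∃ λ j → InT N i j × v i j ℕ.< w i j
    row i with allBelow⊎someBelow (entry i) (suc N)
    ... | inj₁ all = inj₁ all
    ... | inj₂ (j , _ , strict) = inj₂ (j , strict)
  ... | inj₁ all = inj₁ (λ i j t → all i (s≤s (ℕP.≤-trans (ℕP.<⇒≤ (proj₁ (proj₂ t))) (proj₂ (proj₂ t)))) j (s≤s (proj₂ (proj₂ t))) t)
  ... | inj₂ (i , _ , j , strict) = inj₂ (i , j , strict)

-- The simple reflections (n ≥ 2)

module Theorem (m : ℕ) where

  open Window (suc m)

  ≢ₙ-suc : ∀ x → ¬ (x ≡ₙ (x + + 1))
  ≢ₙ-suc x x≡ₙx+1 with divMod x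
  ... | r , q , r<N , refl = r≢suc-r%N (trans (sym (%ℕ-of-divMod r q r<N))
                               (trans x≡ₙx+1 (trans (%ℕ-suc (+ r + q * Nℤ)) (cong (λ z → suc z ℕ.% N) (%ℕ-of-divMod r q r<N)))))
    where
    only-if-N≡1 : ∀ {r} → suc r ≡ N → r ≢ 0
    only-if-N≡1 refl ()
    r≢suc-r%N : r ≢ suc r ℕ.% N
    r≢suc-r%N e with suc r ℕ.<? N
    ... | yes 1+r<N = ℕP.1+n≢n (sym (trans e (ℕD.m<n⇒m%n≡m 1+r<N)))
    ... | no 1+r≮N with ℕP.≤-antisym r<N (ℕP.≮⇒≥ 1+r≮N)
    ...   | 1+r≡N = only-if-N≡1 1+r≡N (trans e (trans (cong (ℕ._% N) 1+r≡N) (ℕD.n%n≡0 N)))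

  δ : ℕ → ℕ → ℤ
  δ k r with r ℕ.≟ k ℕ.% N
  ... | yes _ = + 1
  ... | no _ with r ℕ.≟ suc k ℕ.% N
  ...   | yes _ = - + 1
  ...   | no _  = + 0

  s≡+δ : ∀ k u → s N k u ≡ u + δ k (u %ℕ N)
  s≡+δ k u with u %ℕ N ℕ.≟ k ℕ.% N
  ... | yes _ = refl
  ... | no _ with u %ℕ N ℕ.≟ suc k ℕ.% N
  ...   | yes _ = refl
  ...   | no _  = sym (+-identityʳ u)

  s-periodic : ∀ k u → s N k (u + Nℤ) ≡ s N k u + Nℤ
  s-periodic k u rewrite s≡+δ k (u + Nℤ) | s≡+δ k u =
    trans (cong (λ z → u + Nℤ + δ k z) residue) (ring u Nℤ (δ k (u %ℕ N)))
    where
    residue : (u + Nℤ) %ℕ N ≡ u %ℕ N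
    residue = trans (cong (λ z → (u + z) %ℕ N) (sym (*-identityˡ Nℤ))) (%ℕ-+*N u (+ 1))
    ring : ∀ u n d → u + n + d ≡ u + d + n
    ring = solve-∀

  sAt : ℤ → ℤ → ℤ
  sAt x₀ = s N (x₀ %ℕ N)

  sAt-up : ∀ x₀ u → u ≡ₙ x₀ → sAt x₀ u ≡ u + + 1
  sAt-up x₀ u u≡ₙx₀ = trans (s≡+δ (x₀ %ℕ N) u) (cong (λ z → u + z) (trans (cong (δ (x₀ %ℕ N)) u≡ₙx₀) δ-at-k))
    where
    δ-at-k : δ (x₀ %ℕ N) (x₀ %ℕ N) ≡ + 1
    δ-at-k with x₀ %ℕ N ℕ.≟ (x₀ %ℕ N) ℕ.% N
    ... | yes _ = refl
    ... | no ne = ⊥-elim (ne (sym (ℕD.m<n⇒m%n≡m (n%ℕd<d x₀ N))))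

  sAt-down : ∀ x₀ u → u ≡ₙ (x₀ + + 1) → sAt x₀ u ≡ u - + 1
  sAt-down x₀ u u≡ₙx₀+1 = trans (s≡+δ k u) (cong (λ z → u + z) δ-at-k+1)
    where
    k = x₀ %ℕ N
    δ-at-k+1 : δ k (u %ℕ N) ≡ - + 1
    δ-at-k+1 with u %ℕ N ℕ.≟ k ℕ.% N
    ... | yes e = ⊥-elim (≢ₙ-suc x₀ (sym (trans (sym u≡ₙx₀+1) (trans e (ℕD.m<n⇒m%n≡m (n%ℕd<d x₀ N))))))
    ... | no _ with u %ℕ N ℕ.≟ suc k ℕ.% N
    ...   | yes _ = refl
    ...   | no ne = ⊥-elim (ne (trans u≡ₙx₀+1 (%ℕ-suc x₀)))

  sAt-fix : ∀ x₀ u → ¬ (u ≡ₙ x₀) → ¬ (u ≡ₙ (x₀ + + 1)) → sAt x₀ u ≡ u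
  sAt-fix x₀ u u≢ₙx₀ u≢ₙx₀+1 = trans (s≡+δ k u) (trans (cong (λ z → u + z) δ-elsewhere) (+-identityʳ u))
    where
    k = x₀ %ℕ N
    δ-elsewhere : δ k (u %ℕ N) ≡ + 0
    δ-elsewhere with u %ℕ N ℕ.≟ k ℕ.% N
    ... | yes e = ⊥-elim (u≢ₙx₀ (trans e (ℕD.m<n⇒m%n≡m (n%ℕd<d x₀ N))))
    ... | no _ with u %ℕ N ℕ.≟ suc k ℕ.% N
    ...   | yes e = ⊥-elim (u≢ₙx₀+1 (trans e (sym (%ℕ-suc x₀))))
    ...   | no _  = refl

  sAt-mod : ∀ x₀ a t → a ≡ x₀ + t * Nℤ → ∀ u → sAt x₀ u ≡ sAt a u
  sAt-mod x₀ a t e u = cong (λ r → s N r u) (sym (trans (cong (_%ℕ N) e) (%ℕ-+*N x₀ t)))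

  sAt-involutive : ∀ x₀ u → sAt x₀ (sAt x₀ u) ≡ u
  sAt-involutive x₀ u with u ≡ₙ? x₀ | u ≡ₙ? (x₀ + + 1)
  ... | yes u≡ₙx₀ | _ rewrite sAt-up x₀ u u≡ₙx₀ = trans (sAt-down x₀ (u + + 1) (≡ₙ-suc u x₀ u≡ₙx₀)) (ring u)
    where
    ring : ∀ u → u + + 1 - + 1 ≡ u
    ring = solve-∀
  ... | no _ | yes u≡ₙx₀+1 rewrite sAt-down x₀ u u≡ₙx₀+1 =
    trans (sAt-up x₀ (u - + 1) (≡ₙ-pred (u - + 1) x₀ (subst (_≡ₙ (x₀ + + 1)) (sym (ring u)) u≡ₙx₀+1))) (ring u)
    where
    ring : ∀ u → u - + 1 + + 1 ≡ u
    ring = solve-∀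
  ... | no u≢ₙx₀ | no u≢ₙx₀+1 rewrite sAt-fix x₀ u u≢ₙx₀ u≢ₙx₀+1 = sAt-fix x₀ u u≢ₙx₀ u≢ₙx₀+1

  sAt≤suc : ∀ x₀ u → sAt x₀ u ≤ u + + 1
  sAt≤suc x₀ u with u ≡ₙ? x₀ | u ≡ₙ? (x₀ + + 1)
  ... | yes e | _ = ≤-reflexive (sAt-up x₀ u e)
  ... | no _ | yes e = ≤-trans (≤-reflexive (sAt-down x₀ u e)) (≤-trans (i-j≤i u (+ 1)) (i≤i+j u (+ 1)))
  ... | no n₁ | no n₂ = ≤-trans (≤-reflexive (sAt-fix x₀ u n₁ n₂)) (i≤i+j u (+ 1))

  pred≤sAt : ∀ x₀ u → u - + 1 ≤ sAt x₀ u
  pred≤sAt x₀ u with u ≡ₙ? x₀ | u ≡ₙ? (x₀ + + 1)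
  ... | yes e | _ = ≤-trans (≤-trans (i-j≤i u (+ 1)) (i≤i+j u (+ 1))) (≤-reflexive (sym (sAt-up x₀ u e)))
  ... | no _ | yes e = ≤-reflexive (sym (sAt-down x₀ u e))
  ... | no n₁ | no n₂ = ≤-trans (i-j≤i u (+ 1)) (≤-reflexive (sym (sAt-fix x₀ u n₁ n₂)))

  sAt≤ : ∀ x₀ u → ¬ (u ≡ₙ x₀) → sAt x₀ u ≤ u
  sAt≤ x₀ u n₁ with u ≡ₙ? (x₀ + + 1)
  ... | yes e = ≤-trans (≤-reflexive (sAt-down x₀ u e)) (i-j≤i u (+ 1))
  ... | no n₂ = ≤-reflexive (sAt-fix x₀ u n₁ n₂)

  ≤sAt : ∀ x₀ u → ¬ (u ≡ₙ (x₀ + + 1)) → u ≤ sAt x₀ u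
  ≤sAt x₀ u n₂ with u ≡ₙ? x₀
  ... | yes e = ≤-trans (i≤i+j u (+ 1)) (≤-reflexive (sym (sAt-up x₀ u e)))
  ... | no n₁ = ≤-reflexive (sym (sAt-fix x₀ u n₁ n₂))

  -- Since each value moves by at most one, only the pair (x₀, x₀ + 1) can change order.
  sAt-mono-< : ∀ x₀ u u' → u < u' → ¬ (u ≡ₙ x₀ × u' ≡ u + + 1) → sAt x₀ u < sAt x₀ u'
  sAt-mono-< x₀ u u' u<u' not-swapped with <⇒gap u<u'
  ... | zero , refl = begin-strict
    sAt x₀ u              ≤⟨ sAt≤ x₀ u u≢ₙx₀ ⟩
    u                     <⟨ i<i+1 u ⟩
    u + + 1               ≤⟨ ≤sAt x₀ (u + + 1) (λ e → u≢ₙx₀ (≡ₙ-pred u x₀ e)) ⟩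
    sAt x₀ (u + + 1)      ∎
    where
    open ≤-Reasoning
    u≢ₙx₀ : ¬ (u ≡ₙ x₀)
    u≢ₙx₀ e = not-swapped (e , refl)
  ... | suc zero , refl with u ≡ₙ? x₀
  ...   | yes u≡ₙx₀ = begin-strict
    sAt x₀ u              ≤⟨ sAt≤suc x₀ u ⟩
    u + + 1               <⟨ gap⇒< 0 (ring u) ⟩
    u + + 2               ≤⟨ ≤sAt x₀ (u + + 2) u+2≢ₙx₀+1 ⟩
    sAt x₀ (u + + 2)      ∎
    where
    open ≤-Reasoning
    ring : ∀ u → u + + 2 ≡ u + + 1 + + 1
    ring = solve-∀
    u+2≢ₙx₀+1 : ¬ ((u + + 2) ≡ₙ (x₀ + + 1))
    u+2≢ₙx₀+1 e = ≢ₙ-suc u (trans u≡ₙx₀ (sym (≡ₙ-pred (u + + 1) x₀ (subst (_≡ₙ (x₀ + + 1)) (ring u) e))))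
  ...   | no u≢ₙx₀ = begin-strict
    sAt x₀ u              ≤⟨ sAt≤ x₀ u u≢ₙx₀ ⟩
    u                     <⟨ gap⇒< 0 (ring u) ⟩
    u + + 2 - + 1         ≤⟨ pred≤sAt x₀ (u + + 2) ⟩
    sAt x₀ (u + + 2)      ∎
    where
    open ≤-Reasoning
    ring : ∀ u → u + + 2 - + 1 ≡ u + + 1
    ring = solve-∀
  sAt-mono-< x₀ u u' u<u' not-swapped | suc (suc c) , refl = begin-strict
    sAt x₀ u                            ≤⟨ sAt≤suc x₀ u ⟩
    u + + 1                             <⟨ gap⇒< c (ring u (+ c)) ⟩
    u + + suc (suc (suc c)) - + 1       ≤⟨ pred≤sAt x₀ (u + + suc (suc (suc c))) ⟩
    sAt x₀ (u + + suc (suc (suc c)))    ∎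
    where
    open ≤-Reasoning
    ring : ∀ u c → u + (+ 1 + (+ 1 + (+ 1 + c))) - + 1 ≡ u + + 1 + (+ 1 + c)
    ring = solve-∀

  -- Affine permutations and covers

  PeriodicBijection : (ℤ → ℤ) → Set
  PeriodicBijection f = (∀ x y → f x ≡ f y → x ≡ y) × (∀ z → ∃ λ x → f x ≡ z) × Periodic f

  private
    +1-commute : ∀ a b → a + + 1 + b ≡ a + b + + 1
    +1-commute = solve-∀

  module Ascents (f : ℤ → ℤ) (inj : ∀ x y → f x ≡ f y → x ≡ y) (per : Periodic f) where

    preimage-shift : ∀ x x' t → f x' ≡ f x + t * Nℤ → x' ≡ x + t * Nℤ
    preimage-shift x x' t e = inj x' (x + t * Nℤ) (trans e (sym (periodic-*N f per x t)))

    ascent-unique : ∀ x y x' y' → + 1 ≤ x → x ≤ Nℤ → + 1 ≤ x' → x' ≤ Nℤ →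
                    f y ≡ f x + + 1 → f y' ≡ f x' + + 1 → f x ≡ₙ f x' → x' ≡ x × y' ≡ y
    ascent-unique x y x' y' 1≤x x≤N 1≤x' x'≤N fy fy' fx≡ₙfx' with ≡ₙ⇒multiple (f x) (f x') fx≡ₙfx'
    ... | t , e with preimage-shift x x' t e
    ...   | refl with window-shift≡0 x t 1≤x x≤N 1≤x' x'≤N
    ...     | refl = ring x Nℤ , inj y' y (trans fy' (trans (cong (λ z → f z + + 1) (ring x Nℤ)) (sym fy)))
      where
      ring : ∀ x n → x + + 0 * n ≡ x
      ring = solve-∀

    ascent-descent-distinct : ∀ x y x' y' → x < y → x' < y' → f y ≡ f x + + 1 → f x' ≡ f y' + + 1 → ¬ (f x ≡ₙ f y')
    ascent-descent-distinct x y x' y' x<y x'<y' fy fx' fx≡ₙfy' with ≡ₙ⇒multiple (f x) (f y') fx≡ₙfy'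
    ... | t , e with preimage-shift x y' t e
    ...   | refl with preimage-shift y x' t (trans fx' (trans (cong (_+ + 1) e) (trans (sym (+1-commute (f x) (t * Nℤ))) (cong (_+ t * Nℤ) (sym fy)))))
    ...     | refl = <-asym x<y (<-resp-difference y x x'<y' (ring x y (t * Nℤ)))
      where
      ring : ∀ x y c → y - x ≡ y + c - (x + c)
      ring = solve-∀

  record OneMoreInversion (f h : ℤ → ℤ) (x y : ℤ) : Set where
    field
      new∉ : ¬ Inv N f (x , y)
      new∈ : Inv N h (x , y)
      ⊆new : ∀ Q → Inv N h Q → Inv N f Q ⊎ Q ≡ (x , y)
      old⊆ : ∀ Q → Inv N f Q → Inv N h Q

  module Swap (f h : ℤ → ℤ) (inj : ∀ x y → f x ≡ f y → x ≡ y) (per : Periodic f) where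
    open Ascents f inj per

    private
      ring : ∀ X → X + + 1 - + 1 ≡ X
      ring = solve-∀

      h-keeps-order : ∀ X → (∀ u → h u ≡ sAt X (f u)) → ∀ x' y' → f x' < f y' → ¬ (f x' ≡ₙ X × f y' ≡ f x' + + 1) → h x' < h y'
      h-keeps-order X hs x' y' lt not-swapped = subst₂ _<_ (sym (hs x')) (sym (hs y')) (sAt-mono-< X (f x') (f y') lt not-swapped)

    swapping-ascent : ∀ x y → + 1 ≤ x → x ≤ Nℤ → x < y → f y ≡ f x + + 1 → (∀ u → h u ≡ sAt (f x) (f u)) →
                      OneMoreInversion f h x y
    swapping-ascent x y 1≤x x≤N x<y fy hs = record { new∉ = new∉ ; new∈ = new∈ ; ⊆new = ⊆new ; old⊆ = old⊆ }
      where
      X = f x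
      new∉ : ¬ Inv N f (x , y)
      new∉ (_ , _ , _ , fy<fx) = <-asym fy<fx (subst (f x <_) (sym fy) (i<i+1 X))
      new∈ : Inv N h (x , y)
      new∈ = 1≤x , x≤N , x<y ,
        subst₂ _<_ (sym (trans (hs y) (trans (cong (sAt X) fy) (trans (sAt-down X (X + + 1) refl) (ring X)))))
                   (sym (trans (hs x) (sAt-up X X refl))) (i<i+1 X)
      old⊆ : ∀ Q → Inv N f Q → Inv N h Q
      old⊆ (x' , y') (a , b , x'<y' , fy'<fx') = a , b , x'<y' ,
        h-keeps-order X hs y' x' fy'<fx' (λ { (e , e') → ascent-descent-distinct x y x' y' x<y x'<y' fy e' (sym e) })
      ⊆new : ∀ Q → Inv N h Q → Inv N f Q ⊎ Q ≡ (x , y)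
      ⊆new (x' , y') (a , b , x'<y' , hy'<hx') with f y' <? f x'
      ... | yes fy'<fx' = inj₁ (a , b , x'<y' , fy'<fx')
      ... | no fy'≮fx' with ≮∧≢⇒> fy'≮fx' (λ e → <-irrefl (sym (inj y' x' e)) x'<y') | f x' ≡ₙ? X | f y' ℤ.≟ f x' + + 1
      ...   | _ | yes e | yes e₂ = inj₂ (cong₂ _,_ (proj₁ same) (proj₂ same))
        where same = ascent-unique x y x' y' 1≤x x≤N a b fy e₂ (sym e)
      ...   | fx'<fy' | yes _ | no ne = ⊥-elim (<-asym hy'<hx' (h-keeps-order X hs x' y' fx'<fy' (λ { (_ , e) → ne e })))
      ...   | fx'<fy' | no ne | _ = ⊥-elim (<-asym hy'<hx' (h-keeps-order X hs x' y' fx'<fy' (λ { (e , _) → ne e })))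

    -- Swapping the values of a descent removes an inversion and adds none, so it is never a cover.
    swapping-descent-not-cover : ∀ x y → + 1 ≤ x → x ≤ Nℤ → x < y → f x ≡ f y + + 1 → (∀ u → h u ≡ sAt (f y) (f u)) →
                                 ∀ ℓ → Len N f ℓ → ¬ Len N h (suc ℓ)
    swapping-descent-not-cover x y 1≤x x≤N x<y fx hs ℓ (lf , _ , lenf , memf) (lh , uh , lenh , memh) =
      ℕP.<-irrefl refl (ℕP.<-trans (ℕP.n<1+n ℓ) (subst₂ ℕ._<_ lenh lenf fewer))
      where
      Y = f y
      h⊆f' : ∀ Q → Inv N h Q → Inv N f Q
      h⊆f' (x' , y') (a , b , x'<y' , hy'<hx') with f y' <? f x'
      ... | yes fy'<fx' = a , b , x'<y' , fy'<fx'
      ... | no fy'≮fx' with ≮∧≢⇒> fy'≮fx' (λ e → <-irrefl (sym (inj y' x' e)) x'<y') | f x' ≡ₙ? Y | f y' ℤ.≟ f x' + + 1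
      ...   | _ | yes e | yes e₂ = ⊥-elim (ascent-descent-distinct x' y' x y x'<y' x<y e₂ fx e)
      ...   | fx'<fy' | yes _ | no ne = ⊥-elim (<-asym hy'<hx' (h-keeps-order Y hs x' y' fx'<fy' (λ { (_ , e) → ne e })))
      ...   | fx'<fy' | no ne | _ = ⊥-elim (<-asym hy'<hx' (h-keeps-order Y hs x' y' fx'<fy' (λ { (e , _) → ne e })))
      old : Inv N f (x , y)
      old = 1≤x , x≤N , x<y , subst (f y <_) (sym fx) (i<i+1 Y)
      removed : ¬ Inv N h (x , y)
      removed (_ , _ , _ , hy<hx) = <-asym hy<hx
        (subst₂ _<_ (sym (trans (hs x) (trans (cong (sAt Y) fx) (trans (sAt-down Y (Y + + 1) refl) (ring Y)))))
                    (sym (trans (hs y) (sAt-up Y Y refl))) (i<i+1 Y))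
      old∈ : (x , y) ∈ lf
      old∈ = Equivalence.from (memf (x , y)) old
      new∉ : (x , y) ∉ lh
      new∉ = λ p → removed (Equivalence.to (memh (x , y)) p)
      h⊆f : ∀ {z} → z ∈ lh → z ∈ lf
      h⊆f {z} p = Equivalence.from (memf z) (h⊆f' z (Equivalence.to (memh z) p))
      fewer : length lh ℕ.< length lf
      fewer = Unique-⊂⇒length< (≡-dec ℤ._≟_ ℤ._≟_) lh lf (x , y) uh h⊆f old∈ new∉

  record CoverData (f h : ℤ → ℤ) : Set where
    field
      x y : ℤ
      1≤x : + 1 ≤ x
      x≤N : x ≤ Nℤ
      x<y : x < y
      ascent : f y ≡ f x + + 1
      swap : ∀ u → h u ≡ sAt (f x) (f u)
      oneMore : OneMoreInversion f h x y

  private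
    shift-value : ∀ f → Periodic f → ∀ p t {v} → f p ≡ v → f (p + t * Nℤ) ≡ v + t * Nℤ
    shift-value f per p t e = trans (periodic-*N f per p t) (cong (_+ t * Nℤ) e)

    s≡sAt : ∀ {k} → k ℕ.< N → ∀ u → s N k u ≡ sAt (+ k) u
    s≡sAt k<N u = cong (λ r → s N r u) (sym (ℕD.m<n⇒m%n≡m k<N))

  cover-structure : ∀ f h → PeriodicBijection f → Covers N f h → CoverData f h
  cover-structure f h (inj , surj , per) (k , k<N , hk , ℓ , Lf , Lh) with surj (+ k) | surj (+ k + + 1)
  ... | p₀ , fp₀ | p₁ , fp₁ with <-cmp p₀ p₁
  ... | tri≈ _ refl _ = ⊥-elim (<-irrefl (trans (sym fp₀) fp₁) (i<i+1 (+ k)))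
  ... | tri< p₀<p₁ _ _ with shift-into-window p₀ p₁ p₀<p₁
  ...   | t , 1≤x , x≤N , x<y = record { x = p₀ + t * Nℤ ; y = p₁ + t * Nℤ ; 1≤x = 1≤x ; x≤N = x≤N ; x<y = x<y
                                       ; ascent = ascent ; swap = swap
                                       ; oneMore = Swap.swapping-ascent f h inj per _ _ 1≤x x≤N x<y ascent swap }
    where
    fx = shift-value f per p₀ t fp₀
    ascent : f (p₁ + t * Nℤ) ≡ f (p₀ + t * Nℤ) + + 1
    ascent = trans (shift-value f per p₁ t fp₁) (trans (+1-commute (+ k) (t * Nℤ)) (cong (_+ + 1) (sym fx)))
    swap : ∀ u → h u ≡ sAt (f (p₀ + t * Nℤ)) (f u)
    swap u = trans (hk u) (trans (s≡sAt k<N (f u)) (sAt-mod (+ k) _ t fx (f u)))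
  cover-structure f h (inj , surj , per) (k , k<N , hk , ℓ , Lf , Lh) | p₀ , fp₀ | p₁ , fp₁ | tri> _ _ p₁<p₀
    with shift-into-window p₁ p₀ p₁<p₀
  ... | t , 1≤x , x≤N , x<y = ⊥-elim (Swap.swapping-descent-not-cover f h inj per _ _ 1≤x x≤N x<y descent swap ℓ Lf Lh)
    where
    fy = shift-value f per p₀ t fp₀
    descent : f (p₁ + t * Nℤ) ≡ f (p₀ + t * Nℤ) + + 1
    descent = trans (shift-value f per p₁ t fp₁) (trans (+1-commute (+ k) (t * Nℤ)) (cong (_+ + 1) (sym fy)))
    swap : ∀ u → h u ≡ sAt (f (p₀ + t * Nℤ)) (f u)
    swap u = trans (hk u) (trans (s≡sAt k<N (f u)) (sAt-mod (+ k) _ t fy (f u)))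

  periodicBijection-sAt : ∀ f h X → PeriodicBijection f → (∀ u → h u ≡ sAt X (f u)) → PeriodicBijection h
  periodicBijection-sAt f h X (inj , surj , per) hs = inj' , surj' , per'
    where
    inj' : ∀ a b → h a ≡ h b → a ≡ b
    inj' a b e = inj a b (trans (sym (sAt-involutive X (f a))) (trans (cong (sAt X) (trans (sym (hs a)) (trans e (hs b)))) (sAt-involutive X (f b))))
    surj' : ∀ z → ∃ λ x → h x ≡ z
    surj' z = proj₁ (surj (sAt X z)) , trans (hs _) (trans (cong (sAt X) (proj₂ (surj (sAt X z)))) (sAt-involutive X z))
    per' : Periodic h
    per' u = trans (hs (u + Nℤ)) (trans (cong (sAt X) (per u)) (trans (s-periodic (X %ℕ N) (f u)) (cong (_+ Nℤ) (sym (hs u)))))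

  periodicBijection-≗ : ∀ f g → PeriodicBijection f → f ≗ g → PeriodicBijection g
  periodicBijection-≗ f g (inj , surj , per) f≗g =
    (λ a b e → inj a b (trans (f≗g a) (trans e (sym (f≗g b))))) ,
    (λ z → proj₁ (surj z) , trans (sym (f≗g _)) (proj₂ (surj z))) ,
    (λ u → trans (sym (f≗g (u + Nℤ))) (trans (per u) (cong (_+ Nℤ) (f≗g u))))

  Inv-≗ : ∀ {f g} → f ≗ g → ∀ Q → Inv N f Q → Inv N g Q
  Inv-≗ f≗g (x , y) (a , b , x<y , fy<fx) = a , b , x<y , subst₂ _<_ (f≗g y) (f≗g x) fy<fx

  Len-≗ : ∀ {f g} → f ≗ g → ∀ ℓ → Len N f ℓ → Len N g ℓ
  Len-≗ f≗g ℓ (l , u , len , mem) =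
    l , u , len , λ Q → mk⇔ (λ q → Inv-≗ f≗g Q (Equivalence.to (mem Q) q)) (λ q → Equivalence.from (mem Q) (Inv-≗ (λ z → sym (f≗g z)) Q q))

  Covers-≗ʳ : ∀ {f g g'} → Covers N f g → g ≗ g' → Covers N f g'
  Covers-≗ʳ (k , k<N , gk , ℓ , Lf , Lg) g≗g' = k , k<N , (λ x → trans (sym (g≗g' x)) (gk x)) , ℓ , Lf , Len-≗ g≗g' (suc ℓ) Lg

  leftWeak-≗ʳ : ∀ {f g g'} → LeftWeak N f g → g ≗ g' → LeftWeak N f g'
  leftWeak-≗ʳ (≤-refl f≗g) g≗g' = ≤-refl (λ x → trans (f≗g x) (g≗g' x))
  leftWeak-≗ʳ (≤-step f≤g c) g≗g' = ≤-step f≤g (Covers-≗ʳ c g≗g')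

  leftWeak-≗ˡ : ∀ {f f' g} → f ≗ f' → LeftWeak N f g → LeftWeak N f' g
  leftWeak-≗ˡ f≗f' (≤-refl f≗g) = ≤-refl (λ x → trans (sym (f≗f' x)) (f≗g x))
  leftWeak-≗ˡ f≗f' (≤-step f≤g c) = ≤-step (leftWeak-≗ˡ f≗f' f≤g) c

  cover∷leftWeak : ∀ {f g h} → Covers N f g → LeftWeak N g h → LeftWeak N f h
  cover∷leftWeak c (≤-refl g≗h) = ≤-step (≤-refl (λ _ → refl)) (Covers-≗ʳ c g≗h)
  cover∷leftWeak c (≤-step g≤h c₂) = ≤-step (cover∷leftWeak c g≤h) c₂

  leftWeak⇒Inv⊆ : ∀ f g → PeriodicBijection f → LeftWeak N f g → PeriodicBijection g × (∀ Q → Inv N f Q → Inv N g Q)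
  leftWeak⇒Inv⊆ f g bij (≤-refl f≗g) = periodicBijection-≗ f g bij f≗g , Inv-≗ f≗g
  leftWeak⇒Inv⊆ f h bij (≤-step {g = g} f≤g c) with leftWeak⇒Inv⊆ f g bij f≤g
  ... | bij-g , f⊆g = periodicBijection-sAt g h (g (CoverData.x cd)) bij-g (CoverData.swap cd) ,
                      λ Q q → OneMoreInversion.old⊆ (CoverData.oneMore cd) Q (f⊆g Q q)
    where
    cd = cover-structure g h bij-g c

  Len-oneMore : ∀ f h x y ℓ → Len N f ℓ → OneMoreInversion f h x y → Len N h (suc ℓ)
  Len-oneMore f h x y ℓ (l , u , len , mem) one =
    (x , y) ∷ l , All.tabulate new≢ ∷ u , cong suc len , λ Q → mk⇔ (to Q) (from Q)
    where
    open OneMoreInversion one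
    new≢ : ∀ {Q} → Q ∈ l → (x , y) ≢ Q
    new≢ {Q} Q∈l e = new∉ (subst (Inv N f) (sym e) (Equivalence.to (mem Q) Q∈l))
    to : ∀ Q → Q ∈ (x , y) ∷ l → Inv N h Q
    to Q (here e) = subst (Inv N h) (sym e) new∈
    to Q (there Q∈l) = old⊆ Q (Equivalence.to (mem Q) Q∈l)
    from : ∀ Q → Inv N h Q → Q ∈ (x , y) ∷ l
    from Q q with ⊆new Q q
    ... | inj₁ q' = there (Equivalence.from (mem Q) q')
    ... | inj₂ e = here e

  Len-id : Len N (λ x → x) 0
  Len-id = [] , [] , refl , λ Q → mk⇔ (λ ()) (λ { (_ , _ , x<y , y<x) → ⊥-elim (<-asym x<y y<x) })

  -- Bumping an entry is a left multiplication

  module BumpStep (v : ℕ → ℕ → ℕ) (adm : Admitted N v) (r c : ℕ) (t : ℤ)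
                  (1≤r : 1 ℕ.≤ r) (r<c : r ℕ.< c) (c≤N : c ℕ.≤ N)
                  (ascent : Fwin N v r + t * Nℤ ≡ Fwin N v c + + 1) where

    open Bump v r c 1≤r r<c c≤N

    a : ℕ → ℤ
    a = Fwin N v

    table : FloorTable a v
    table = Fwin-floorTable v adm

    r≤N : r ℕ.≤ N
    r≤N = ℕP.≤-trans (ℕP.<⇒≤ r<c) c≤N

    1≤c : 1 ℕ.≤ c
    1≤c = ℕP.≤-trans 1≤r (ℕP.<⇒≤ r<c)

    v' : ℕ → ℕ → ℕ
    v' = bump v r c

    a' : ℕ → ℤ
    a' = Fwin N v'

    1<N : + 1 < Nℤ
    1<N = +<+ (s≤s (s≤s z≤n))

    a-r : a r ≡ a c + + 1 - t * Nℤ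
    a-r = trans (ring (a r) (t * Nℤ)) (cong (_- t * Nℤ) ascent)
      where
      ring : ∀ x y → x ≡ x + y - y
      ring = solve-∀

    -- a_c − a_r = tN − 1 together with N ≥ 2 forces t = v_rc + 1.
    t≡1+v : t ≡ + suc (v r c)
    t≡1+v = ≤-antisym (≤-resp-difference t (+ suc (v r c)) t-1≤v (ring₁ t (+ v r c)))
                      (i<j⇒suc[i]≤j v<t)
      where
      diff : a c - a r ≡ t * Nℤ - + 1
      diff = trans (cong (λ z → a c - z) a-r) (ring₂ (a c) (t * Nℤ))
        where
        ring₂ : ∀ x y → x - (x + + 1 - y) ≡ y - + 1
        ring₂ = solve-∀
      ring₁ : ∀ t v → t - (+ 1 + v) ≡ t - + 1 - v
      ring₁ = solve-∀
      ring₃ : ∀ x → x - + 1 - x ≡ + 0 - + 1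
      ring₃ = solve-∀
      ring₄ : ∀ t n → (t - + 1) * n - (t * n - + 1) ≡ + 1 - n
      ring₄ = solve-∀
      v<t : + v r c < t
      v<t = floor-minimal (table r c 1≤r r<c c≤N)
              (subst (_< t * Nℤ) (sym diff) (<-resp-difference (t * Nℤ - + 1) (t * Nℤ) (i<i+1 (+ 0)) (ring₃ (t * Nℤ))))
      t-1≤v : t - + 1 ≤ + v r c
      t-1≤v = floor-maximal (table r c 1≤r r<c c≤N)
                (subst ((t - + 1) * Nℤ <_) (sym diff) (<-resp-difference ((t - + 1) * Nℤ) (t * Nℤ - + 1) 1<N (ring₄ t Nℤ)))

    private
      c≢r : c ≢ r
      c≢r e = ℕP.<-irrefl (sym e) r<c

      distinct : ∀ i j → 1 ℕ.≤ i → i ℕ.≤ N → 1 ℕ.≤ j → j ℕ.≤ N → i ≢ j → ∀ t → a j ≢ a i + t * Nℤ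
      distinct = floorTable-residues-distinct a v table

    BumpedFloor : ℕ → ℕ → Set
    BumpedFloor i j = StrictFloor (a' j - a' i) (+ v' i j)

    floor-rc : BumpedFloor r c
    floor-rc = subst₂ StrictFloor (sym diff) (sym entry) (strictFloor (i<i+1 (t * Nℤ)) (+-monoʳ-< (t * Nℤ) 1<N))
      where
      ring₁ : ∀ ac ar → ac + + 1 - (ar - + 1) ≡ (ac + + 1) - ar + + 1
      ring₁ = solve-∀
      ring₂ : ∀ ar tn → ar + tn - ar + + 1 ≡ tn + + 1
      ring₂ = solve-∀
      diff : a' c - a' r ≡ t * Nℤ + + 1
      diff = trans (cong₂ _-_ Fwin-bump-c Fwin-bump-r)
               (trans (ring₁ (a c) (a r)) (trans (cong (λ z → z - a r + + 1) (sym ascent)) (ring₂ (a r) (t * Nℤ))))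
      entry : + v' r c ≡ t
      entry = trans (cong +_ (bump-at v r c)) (sym t≡1+v)

    floor-rj : ∀ j → r ℕ.< j → j ℕ.≤ N → j ≢ c → BumpedFloor r j
    floor-rj j r<j j≤N j≢c = subst₂ StrictFloor (sym diff) (sym entry) (floor-suc (table r j 1≤r r<j j≤N) not-multiple)
      where
      1≤j = ℕP.≤-trans 1≤r (ℕP.<⇒≤ r<j)
      j≢r : j ≢ r
      j≢r e = ℕP.<-irrefl (sym e) r<j
      ring₁ : ∀ aj ar → aj - (ar - + 1) ≡ aj - ar + + 1
      ring₁ = solve-∀
      ring₂ : ∀ aj ar → aj ≡ (aj - ar + + 1) + (ar - + 1)
      ring₂ = solve-∀
      ring₃ : ∀ w n ac t → (w + + 1) * n + (ac + + 1 - t * n - + 1) ≡ ac + (w + + 1 - t) * n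
      ring₃ = solve-∀
      diff : a' j - a' r ≡ a j - a r + + 1
      diff = trans (cong₂ _-_ (Fwin-bump-other j j≢r j≢c) Fwin-bump-r) (ring₁ (a j) (a r))
      entry : + v' r j ≡ + v r j
      entry = cong +_ (bump-elsewhere v r c r j (inj₂ j≢c))
      not-multiple : a j - a r + + 1 ≢ (+ v r j + + 1) * Nℤ
      not-multiple e = distinct c j 1≤c c≤N 1≤j j≤N (λ c≡j → j≢c (sym c≡j)) (+ v r j + + 1 - t)
        (trans (ring₂ (a j) (a r)) (trans (cong₂ _+_ e (cong (_- + 1) a-r)) (ring₃ (+ v r j) Nℤ (a c) t)))

    floor-cj : ∀ j → c ℕ.< j → j ℕ.≤ N → BumpedFloor c j
    floor-cj j c<j j≤N = subst₂ StrictFloor (sym diff) (sym entry) (floor-pred (table c j 1≤c c<j j≤N) not-multiple)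
      where
      1≤j = ℕP.≤-trans 1≤c (ℕP.<⇒≤ c<j)
      j≢r : j ≢ r
      j≢r e = ℕP.<-irrefl (sym e) (ℕP.<-trans r<c c<j)
      j≢c : j ≢ c
      j≢c e = ℕP.<-irrefl (sym e) c<j
      ring₁ : ∀ aj ac → aj - (ac + + 1) ≡ aj - ac - + 1
      ring₁ = solve-∀
      ring₂ : ∀ aj ac → aj ≡ (aj - ac - + 1) + (ac + + 1)
      ring₂ = solve-∀
      ring₃ : ∀ w n ar tn → w * n + (ar + tn) ≡ ar + (tn + w * n)
      ring₃ = solve-∀
      ring₄ : ∀ t w n → t * n + w * n ≡ (t + w) * n
      ring₄ = solve-∀
      diff : a' j - a' c ≡ a j - a c - + 1
      diff = trans (cong₂ _-_ (Fwin-bump-other j j≢r j≢c) Fwin-bump-c) (ring₁ (a j) (a c))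
      entry : + v' c j ≡ + v c j
      entry = cong +_ (bump-elsewhere v r c c j (inj₁ c≢r))
      not-multiple : a j - a c - + 1 ≢ + v c j * Nℤ
      not-multiple e = distinct r j 1≤r r≤N 1≤j j≤N (λ r≡j → j≢r (sym r≡j)) (t + + v c j)
        (trans (ring₂ (a j) (a c)) (trans (cong₂ _+_ e (sym ascent))
          (trans (ring₃ (+ v c j) Nℤ (a r) (t * Nℤ)) (cong (λ z → a r + z) (ring₄ t (+ v c j) Nℤ)))))

    floor-ir : ∀ i → 1 ℕ.≤ i → i ℕ.< r → BumpedFloor i r
    floor-ir i 1≤i i<r = subst₂ StrictFloor (sym diff) (sym entry) (floor-pred (table i r 1≤i i<r r≤N) not-multiple)
      where
      i≤N = ℕP.≤-trans (ℕP.<⇒≤ i<r) r≤N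
      i≢r : i ≢ r
      i≢r e = ℕP.<-irrefl e i<r
      i≢c : i ≢ c
      i≢c e = ℕP.<-irrefl e (ℕP.<-trans i<r r<c)
      ring₁ : ∀ ar ai → ar - + 1 - ai ≡ ar - ai - + 1
      ring₁ = solve-∀
      ring₂ : ∀ ac ar tn ai → ac ≡ (ar - ai - + 1) + ai + tn + (ac + + 1 - (ar + tn))
      ring₂ = solve-∀
      ring₃ : ∀ wn ai tn → wn + ai + tn + + 0 ≡ ai + (tn + wn)
      ring₃ = solve-∀
      ring₄ : ∀ t w n → t * n + w * n ≡ (w + t) * n
      ring₄ = solve-∀
      ring₅ : ∀ x → x - x ≡ + 0
      ring₅ = solve-∀
      diff : a' r - a' i ≡ a r - a i - + 1
      diff = trans (cong₂ _-_ Fwin-bump-r (Fwin-bump-other i i≢r i≢c)) (ring₁ (a r) (a i))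
      entry : + v' i r ≡ + v i r
      entry = cong +_ (bump-elsewhere v r c i r (inj₂ (λ r≡c → c≢r (sym r≡c))))
      not-multiple : a r - a i - + 1 ≢ + v i r * Nℤ
      not-multiple e = distinct i c 1≤i i≤N 1≤c c≤N i≢c (+ v i r + t)
        (trans (ring₂ (a c) (a r) (t * Nℤ) (a i))
          (trans (cong₂ (λ x y → x + a i + t * Nℤ + y) e (trans (cong (_- (a r + t * Nℤ)) (sym ascent)) (ring₅ (a r + t * Nℤ))))
            (trans (ring₃ (+ v i r * Nℤ) (a i) (t * Nℤ)) (cong (λ z → a i + z) (ring₄ t (+ v i r) Nℤ)))))

    floor-ic : ∀ i → 1 ℕ.≤ i → i ℕ.< c → i ≢ r → BumpedFloor i c
    floor-ic i 1≤i i<c i≢r = subst₂ StrictFloor (sym diff) (sym entry) (floor-suc (table i c 1≤i i<c c≤N) not-multiple)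
      where
      i≤N = ℕP.≤-trans (ℕP.<⇒≤ i<c) c≤N
      i≢c : i ≢ c
      i≢c e = ℕP.<-irrefl e i<c
      ring₁ : ∀ ac ai → ac + + 1 - ai ≡ ac - ai + + 1
      ring₁ = solve-∀
      ring₂ : ∀ ac ai tn → ac + + 1 - tn ≡ (ac - ai + + 1) + ai - tn
      ring₂ = solve-∀
      ring₃ : ∀ w n ai t → (w + + 1) * n + ai - t * n ≡ ai + (w + + 1 - t) * n
      ring₃ = solve-∀
      diff : a' c - a' i ≡ a c - a i + + 1
      diff = trans (cong₂ _-_ Fwin-bump-c (Fwin-bump-other i i≢r i≢c)) (ring₁ (a c) (a i))
      entry : + v' i c ≡ + v i c
      entry = cong +_ (bump-elsewhere v r c i c (inj₁ i≢r))
      not-multiple : a c - a i + + 1 ≢ (+ v i c + + 1) * Nℤ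
      not-multiple e = distinct i r 1≤i i≤N 1≤r r≤N i≢r (+ v i c + + 1 - t)
        (trans a-r (trans (ring₂ (a c) (a i) (t * Nℤ)) (trans (cong (λ z → z + a i - t * Nℤ) e) (ring₃ (+ v i c) Nℤ (a i) t))))

    floor-other : ∀ i j → 1 ℕ.≤ i → i ℕ.< j → j ℕ.≤ N → i ≢ r → i ≢ c → j ≢ r → j ≢ c → BumpedFloor i j
    floor-other i j 1≤i i<j j≤N i≢r i≢c j≢r j≢c =
      subst₂ StrictFloor (sym (cong₂ _-_ (Fwin-bump-other j j≢r j≢c) (Fwin-bump-other i i≢r i≢c)))
                         (sym (cong +_ (bump-elsewhere v r c i j (inj₁ i≢r)))) (table i j 1≤i i<j j≤N)

    bump-floorTable : FloorTable a' v'
    bump-floorTable i j 1≤i i<j j≤N = go (i ℕ.≟ r) (j ℕ.≟ c) (i ℕ.≟ c) (j ℕ.≟ r)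
      where
      go : Dec (i ≡ r) → Dec (j ≡ c) → Dec (i ≡ c) → Dec (j ≡ r) → BumpedFloor i j
      go (yes refl) (yes refl) _ _ = floor-rc
      go (yes refl) (no j≢c) _ _ = floor-rj j i<j j≤N j≢c
      go (no _) _ (yes refl) _ = floor-cj j i<j j≤N
      go (no i≢r) (yes refl) (no _) _ = floor-ic i 1≤i i<j i≢r
      go (no _) (no _) (no _) (yes refl) = floor-ir i 1≤i i<j
      go (no i≢r) (no j≢c) (no i≢c) (no j≢r) = floor-other i j 1≤i i<j j≤N i≢r i≢c j≢r j≢c

    bump-admitted : suc r ≢ c → Admitted N v'
    bump-admitted non-adjacent = adjacent-zero , floorTable⇒triangle a' v' bump-floorTable
      where
      adjacent-zero : ∀ i → 1 ℕ.≤ i → suc i ℕ.≤ N → v' i (suc i) ≡ 0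
      adjacent-zero i 1≤i i<N = trans (bump-elsewhere v r c i (suc i) (not-bumped (i ℕ.≟ r))) (proj₁ adm i 1≤i i<N)
        where
        not-bumped : Dec (i ≡ r) → i ≢ r ⊎ suc i ≢ c
        not-bumped (no i≢r) = inj₁ i≢r
        not-bumped (yes refl) = inj₂ non-adjacent

    sAt-ext : ∀ u → sAt (a c) (ext N a u) ≡ ext N a' u
    sAt-ext u with windowDecomp u
    ... | i , q , 1≤i , i≤N , refl rewrite ext-window a i q 1≤i i≤N | ext-window a' i q 1≤i i≤N = go (i ℕ.≟ c) (i ℕ.≟ r)
      where
      go : Dec (i ≡ c) → Dec (i ≡ r) → sAt (a c) (a i + q * Nℤ) ≡ a' i + q * Nℤ
      go (yes refl) _ = trans (sAt-up (a c) (a c + q * Nℤ) (sym (multiple⇒≡ₙ {a c} q refl)))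
                              (trans (ring (a c) (q * Nℤ)) (cong (_+ q * Nℤ) (sym Fwin-bump-c)))
        where
        ring : ∀ x y → x + y + + 1 ≡ x + + 1 + y
        ring = solve-∀
      go (no _) (yes refl) = trans (sAt-down (a c) (a r + q * Nℤ)
                                     (sym (multiple⇒≡ₙ {a c + + 1} (q - t) (trans (cong (_+ q * Nℤ) a-r) (ring₂ (a c) t q Nℤ)))))
                                   (trans (ring₁ (a r) (q * Nℤ)) (cong (_+ q * Nℤ) (sym Fwin-bump-r)))
        where
        ring₁ : ∀ x y → x + y - + 1 ≡ x - + 1 + y
        ring₁ = solve-∀
        ring₂ : ∀ ac t q n → ac + + 1 - t * n + q * n ≡ ac + + 1 + (q - t) * n
        ring₂ = solve-∀
      go (no i≢c) (no i≢r) = trans (sAt-fix (a c) (a i + q * Nℤ) ≢ₙac ≢ₙac+1) (cong (_+ q * Nℤ) (sym (Fwin-bump-other i i≢r i≢c)))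
        where
        ring₁ : ∀ ai q s n → ai + q * n + s * n ≡ ai + (q + s) * n
        ring₁ = solve-∀
        ring₂ : ∀ ai q s t n → ai + q * n + s * n - t * n ≡ ai + (q + s - t) * n
        ring₂ = solve-∀
        ≢ₙac : ¬ ((a i + q * Nℤ) ≡ₙ a c)
        ≢ₙac e with ≡ₙ⇒multiple (a i + q * Nℤ) (a c) e
        ... | s , e₂ = distinct i c 1≤i i≤N 1≤c c≤N i≢c (q + s) (trans e₂ (ring₁ (a i) q s Nℤ))
        ≢ₙac+1 : ¬ ((a i + q * Nℤ) ≡ₙ (a c + + 1))
        ≢ₙac+1 e with ≡ₙ⇒multiple (a i + q * Nℤ) (a c + + 1) e
        ... | s , e₂ = distinct i r 1≤i i≤N 1≤r r≤N i≢r (q + s - t) (trans a-r (trans (cong (_- t * Nℤ) e₂) (ring₂ (a i) q s t Nℤ)))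

  F : (ℕ → ℕ → ℕ) → ℤ → ℤ
  F v = ext N (Fwin N v)

  F-periodicBijection : ∀ v → Admitted N v → PeriodicBijection (F v)
  F-periodicBijection v adm = ext-injective a v table , ext-surjective a v table , ext-periodic a
    where
    a = Fwin N v
    table = Fwin-floorTable v adm

  record Raised (v w : ℕ → ℕ → ℕ) (c : ℕ) : Set where
    field
      v' : ℕ → ℕ → ℕ
      admitted : Admitted N v'
      ≤w : v ≤[ N ]T w → v' ≤[ N ]T w
      total-suc : total v' ≡ suc (total v)
      swap : ∀ u → F v' u ≡ sAt (F v (+ c)) (F v u)
      covers : ∀ ℓ → Len N (F v) ℓ → Covers N (F v) (F v') × Len N (F v') (suc ℓ)

  raise : ∀ v w → Admitted N v → Admitted N w → ∀ c y → 1 ℕ.≤ c → c ℕ.≤ N →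
          F v y ≡ F v (+ c) + + 1 → Inv N (F w) (+ c , y) → Raised v w c
  raise v w adm-v adm-w c y 1≤c c≤N ascent inv with windowDecomp y
  ... | r , t , 1≤r , r≤N , refl with inversion⇒floor (Fwin N w) w (Fwin-floorTable w adm-w) c r t 1≤c c≤N 1≤r r≤N inv
  ... | r<c , _ , t≤w = record
    { v' = bump v r c
    ; admitted = bump-admitted non-adjacent
    ; ≤w = ≤w
    ; total-suc = total-bump v r c 1≤r r<c c≤N
    ; swap = swap
    ; covers = λ ℓ Lv → let Lv' = Len-oneMore (F v) (F (bump v r c)) (+ c) (+ r + t * Nℤ) ℓ Lv oneMore
                        in (a c %ℕ N , n%ℕd<d (a c) N , (λ u → sym (sAt-ext u)) , ℓ , Lv , Lv') , Lv'
    }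
    where
    a = Fwin N v
    window-ascent : a r + t * Nℤ ≡ a c + + 1
    window-ascent = trans (sym (ext-window a r t 1≤r r≤N)) (trans ascent (cong (_+ + 1) (ext-pos a c 1≤c c≤N)))
    open BumpStep v adm-v r c t 1≤r r<c c≤N window-ascent using (t≡1+v; bump-admitted; sAt-ext)
    raised≤w : suc (v r c) ℕ.≤ w r c
    raised≤w = +≤+⁻¹ (subst (_≤ + w r c) t≡1+v t≤w)
    non-adjacent : suc r ≢ c
    non-adjacent refl = ℕP.<-irrefl (sym (proj₁ adm-w r 1≤r c≤N)) (ℕP.<-≤-trans (s≤s z≤n) raised≤w)
    ≤w : v ≤[ N ]T w → bump v r c ≤[ N ]T w
    ≤w v≤w i j ij = go (i ℕ.≟ r) (j ℕ.≟ c)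
      where
      go : Dec (i ≡ r) → Dec (j ≡ c) → bump v r c i j ℕ.≤ w i j
      go (yes refl) (yes refl) = subst (ℕ._≤ w i j) (sym (bump-at v r c)) raised≤w
      go (yes _) (no j≢c) = subst (ℕ._≤ w i j) (sym (bump-elsewhere v r c i j (inj₂ j≢c))) (v≤w i j ij)
      go (no i≢r) _ = subst (ℕ._≤ w i j) (sym (bump-elsewhere v r c i j (inj₁ i≢r))) (v≤w i j ij)
    swap : ∀ u → F (bump v r c) u ≡ sAt (F v (+ c)) (F v u)
    swap u = trans (sym (sAt-ext u)) (cong (λ z → sAt z (F v u)) (sym (ext-pos a c 1≤c c≤N)))
    oneMore : OneMoreInversion (F v) (F (bump v r c)) (+ c) (+ r + t * Nℤ)
    oneMore = Swap.swapping-ascent (F v) (F (bump v r c)) (ext-injective a v (Fwin-floorTable v adm-v)) (ext-periodic a)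
                (+ c) (+ r + t * Nℤ) (+≤+ 1≤c) (+≤+ c≤N) (proj₁ (proj₂ (proj₂ inv))) ascent swap

  new-inversion : ∀ v w → Admitted N v → Admitted N w → ∀ i j → InT N i j → v i j ℕ.< w i j →
                  ∃ λ p → + j < p × F v (+ j) < F v p × F w p < F w (+ j)
  new-inversion v w adm-v adm-w i j (1≤i , i<j , j≤N) v<w =
    p , j<p , fj<fp , proj₂ (proj₂ (proj₂ inv-w))
    where
    a = Fwin N v
    table = Fwin-floorTable v adm-v
    p : ℤ
    p = + i + + suc (v i j) * Nℤ
    1≤j = ℕP.≤-trans 1≤i (ℕP.<⇒≤ i<j)
    i≤N = ℕP.≤-trans (ℕP.<⇒≤ i<j) j≤N
    inv-w : Inv N (F w) (+ j , p)
    inv-w = floor⇒inversion (Fwin N w) w (Fwin-floorTable w adm-w) i j (+ suc (v i j)) 1≤i i<j j≤N (+≤+ (s≤s z≤n)) (+≤+ v<w)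
    j<p : + j < p
    j<p = proj₁ (proj₂ (proj₂ inv-w))
    fj<fp : F v (+ j) < F v p
    fj<fp with F v p <? F v (+ j)
    ... | yes fp<fj = ⊥-elim (ℕP.<-irrefl refl (+≤+⁻¹ (proj₂ (proj₂
            (inversion⇒floor a v table j i (+ suc (v i j)) 1≤j j≤N 1≤i i≤N (+≤+ 1≤j , +≤+ j≤N , j<p , fp<fj))))))
    ... | no fp≮fj = ≮∧≢⇒> fp≮fj (λ e → <-irrefl (ext-injective a v table (+ j) p (sym e)) j<p)

  ascent-in-window : ∀ v w → Admitted N v → Admitted N w → ∀ q q' → q < q' → F v q' ≡ F v q + + 1 → F w q' < F w q →
                     ∃ λ c → ∃ λ y → 1 ℕ.≤ c × c ℕ.≤ N × F v y ≡ F v (+ c) + + 1 × Inv N (F w) (+ c , y)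
  ascent-in-window v w adm-v adm-w q q' q<q' fq' gq'<gq with shift-into-window q q' q<q'
  ... | t , 1≤x , x≤N , x<y with window-position (q + t * Nℤ) 1≤x x≤N
  ...   | c , 1≤c , c≤N , c≡x = c , q' + t * Nℤ , 1≤c , c≤N , subst (λ z → F v (q' + t * Nℤ) ≡ F v z + + 1) (sym c≡x) ascent ,
                                subst (λ z → Inv N (F w) (z , q' + t * Nℤ)) (sym c≡x) (1≤x , x≤N , x<y , inverted)
    where
    shifted : ∀ v p → F v (p + t * Nℤ) ≡ F v p + t * Nℤ
    shifted v p = periodic-*N (F v) (ext-periodic (Fwin N v)) p t
    ascent : F v (q' + t * Nℤ) ≡ F v (q + t * Nℤ) + + 1
    ascent = trans (shifted v q') (trans (cong (_+ t * Nℤ) fq') (trans (+1-commute (F v q) (t * Nℤ)) (cong (_+ + 1) (sym (shifted v q)))))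
    inverted : F w (q' + t * Nℤ) < F w (q + t * Nℤ)
    inverted = subst₂ _<_ (sym (shifted w q')) (sym (shifted w q)) (+-monoˡ-< (t * Nℤ) gq'<gq)

  inverted-ascent : ∀ v w → Admitted N v → Admitted N w → v ≤[ N ]T w → ∀ i j → InT N i j → v i j ℕ.< w i j →
                    ∃ λ c → ∃ λ y → 1 ℕ.≤ c × c ℕ.≤ N × F v y ≡ F v (+ c) + + 1 × Inv N (F w) (+ c , y)
  inverted-ascent v w adm-v adm-w v≤w i j ij v<w =
    let (p , j<p , fj<fp , gp<gj) = new-inversion v w adm-v adm-w i j ij v<w
        (D , fp) = <⇒gap fj<fp
        (q , q' , q<q' , fq' , gq'<gq) = ascent-inverted-somewhere (F v) (F w) (ext-surjective (Fwin N v) v table-v)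
                                           (inversions-mono (Fwin N v) v (Fwin N w) w table-v (Fwin-floorTable w adm-w) v≤w) D (+ j) p j<p fp gp<gj
    in ascent-in-window v w adm-v adm-w q q' q<q' fq' gq'<gq
    where
    table-v = Fwin-floorTable v adm-v

  -- Raising v towards w one entry at a time is a chain of covers, by induction on total w − total v.
  ≤T⇒leftWeak : ∀ d v w → Admitted N v → Admitted N w → v ≤[ N ]T w → total v ℕ.+ d ≡ total w →
                ∀ ℓ → Len N (F v) ℓ → LeftWeak N (F v) (F w) × ∃ (Len N (F w))
  ≤T⇒leftWeak d v w adm-v adm-w v≤w sum ℓ Lv with ≤T⇒≡T⊎<somewhere v w v≤w
  ... | inj₁ v≡w = ≤-refl F≗ , ℓ , Len-≗ F≗ ℓ Lv
    where F≗ = ext-cong _ _ (Fwin-cong v w v≡w)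
  ≤T⇒leftWeak zero v w adm-v adm-w v≤w sum ℓ Lv | inj₂ (i , j , ij , v<w) =
    ⊥-elim (ℕP.<-irrefl (trans (sym (ℕP.+-identityʳ (total v))) sum) (total-mono-< v w v≤w i j ij v<w))
  ≤T⇒leftWeak (suc d) v w adm-v adm-w v≤w sum ℓ Lv | inj₂ (i , j , ij , v<w) =
    let (c , y , 1≤c , c≤N , ascent , inv) = inverted-ascent v w adm-v adm-w v≤w i j ij v<w
        raised = raise v w adm-v adm-w c y 1≤c c≤N ascent inv
        open Raised raised
        (cover , Lv') = covers ℓ Lv
        (rest , Lw) = ≤T⇒leftWeak d v' w admitted adm-w (≤w v≤w)
                        (trans (cong (ℕ._+ d) total-suc) (trans (sym (ℕP.+-suc (total v) d)) sum)) (suc ℓ) Lv'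
    in cover∷leftWeak cover rest , Lw

  -- The largest admitted vector and f_c

  vmax : ℕ → ℕ → ℕ
  vmax i j = j ∸ suc i

  private
    ∸-suc : ∀ a b → a ℕ.< b → b ∸ a ≡ suc (b ∸ suc a)
    ∸-suc zero    (suc b) _         = refl
    ∸-suc (suc a) (suc b) (s≤s a<b) = ∸-suc a b a<b

    ∸-split : ∀ a b c → a ℕ.≤ b → b ℕ.≤ c → c ∸ a ≡ (b ∸ a) ℕ.+ (c ∸ b)
    ∸-split a b c a≤b b≤c = trans (cong (_∸ a) c≡) (ℕP.m+n∸m≡n a _)
      where
      c≡ : c ≡ a ℕ.+ ((b ∸ a) ℕ.+ (c ∸ b))
      c≡ = trans (sym (ℕP.m+[n∸m]≡n b≤c)) (trans (cong (ℕ._+ (c ∸ b)) (sym (ℕP.m+[n∸m]≡n a≤b))) (ℕP.+-assoc a (b ∸ a) (c ∸ b)))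

  vmax-admitted : Admitted N vmax
  vmax-admitted = (λ i _ _ → ℕP.n∸n≡0 i) , triangle
    where
    triangle : ∀ i j k → 1 ℕ.≤ i → i ℕ.< j → j ℕ.< k → k ℕ.≤ N →
               vmax i j ℕ.+ vmax j k ℕ.≤ vmax i k × vmax i k ℕ.≤ suc (vmax i j ℕ.+ vmax j k)
    triangle i j k _ i<j j<k _ = subst (vmax i j ℕ.+ vmax j k ℕ.≤_) (sym e) (ℕP.n≤1+n _) , ℕP.≤-reflexive e
      where
      e : vmax i k ≡ suc (vmax i j ℕ.+ vmax j k)
      e = trans (∸-split (suc i) j k i<j (ℕP.<⇒≤ j<k)) (trans (cong (vmax i j ℕ.+_) (∸-suc j k j<k)) (ℕP.+-suc (vmax i j) (vmax j k)))

  -- Along a row, the triangle inequality with v_{j,j+1} = 0 lets v_ij grow by at most one per step.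
  ≤vmax : ∀ v → Admitted N v → v ≤[ N ]T vmax
  ≤vmax v (adjacent , triangle) i j (1≤i , i<j , j≤N) =
    subst (λ z → v i z ℕ.≤ vmax i j) (ℕP.m+[n∸m]≡n i<j) (row (j ∸ suc i) (subst (ℕ._≤ N) (sym (ℕP.m+[n∸m]≡n i<j)) j≤N))
    where
    row : ∀ g → suc i ℕ.+ g ℕ.≤ N → v i (suc i ℕ.+ g) ℕ.≤ g
    row zero i+1≤N rewrite ℕP.+-identityʳ (suc i) = ℕP.≤-reflexive (adjacent i 1≤i i+1≤N)
    row (suc g) i+g+2≤N = subst (λ z → v i z ℕ.≤ suc g) (sym (ℕP.+-suc (suc i) g)) bound
      where
      j' = suc i ℕ.+ g
      k≤N : suc j' ℕ.≤ N
      k≤N = subst (ℕ._≤ N) (ℕP.+-suc (suc i) g) i+g+2≤N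
      t = triangle i j' (suc j') 1≤i (s≤s (ℕP.m≤m+n i g)) ℕP.≤-refl k≤N
      v-adj : v j' (suc j') ≡ 0
      v-adj = adjacent j' (ℕP.≤-trans 1≤i (ℕP.≤-trans (ℕP.m≤m+n i g) (ℕP.n≤1+n _))) k≤N
      bound : v i (suc j') ℕ.≤ suc g
      bound = ℕP.≤-trans (proj₂ t) (s≤s (subst (λ z → v i j' ℕ.+ z ℕ.≤ g) (sym v-adj)
                (subst (ℕ._≤ g) (sym (ℕP.+-identityʳ _)) (row g (ℕP.<⇒≤ k≤N)))))

  Fwin-vmax-1 : Fwin N vmax 1 ≡ cwin N 1
  Fwin-vmax-1 = sym (trans (cong (λ z → - (z /ℕ 2)) numerator) (trans (cong -_ (halve (+ S - + 1))) (ring₃ (+ S))))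
    where
    S = sumTo (suc m) (λ t → t ∸ 1)
    halve : ∀ z → (z * + 2) /ℕ 2 ≡ z
    halve z = trans (cong (_/ℕ 2) (sym (+-identityˡ (z * + 2)))) (Window./ℕ-of-divMod 1 0 z (s≤s z≤n))
    2S : + 2 * + S ≡ (+ 1 + + m) * + m
    2S = trans (sym (pos-* 2 S)) (trans (cong +_ (2*sumTo-pred (suc m))) (pos-* (suc m) m))
    ring₁ : ∀ M → (+ 2 + M) * ((+ 2 + M) - + 3) ≡ (+ 1 + M) * M - + 2
    ring₁ = solve-∀
    ring₂ : ∀ S → + 2 * S - + 2 ≡ (S - + 1) * + 2
    ring₂ = solve-∀
    ring₃ : ∀ S → - (S - + 1) ≡ + 1 + + 0 - S
    ring₃ = solve-∀
    numerator : Nℤ * (Nℤ - + 3) ≡ (+ S - + 1) * + 2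
    numerator = trans (ring₁ (+ m)) (trans (cong (_- + 2) (sym 2S)) (ring₂ (+ S)))

  ψ-diff-vmax : ∀ i p → 1 ℕ.≤ i → p ≢ i → ψ-diff vmax i (suc i) p ≡ + 1
  ψ-diff-vmax i p 1≤i p≢i = go (ℕ.<-cmp p i) (p ℕ.≟ suc i)
    where
    ring₁ : ∀ x → + 1 + x + + 1 - (x + + 1) ≡ + 1
    ring₁ = solve-∀
    ring₂ : ∀ x → - x - - (+ 1 + x) ≡ + 1
    ring₂ = solve-∀
    go : Tri (p ℕ.< i) (p ≡ i) (i ℕ.< p) → Dec (p ≡ suc i) → ψ-diff vmax i (suc i) p ≡ + 1
    go (tri< p<i _ _) _ = trans (cong₂ _-_ (ψ-< vmax (suc i) p (ℕP.m≤n⇒m≤1+n p<i)) (ψ-< vmax i p p<i))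
                                (trans (cong (λ z → + z + + 1 - (+ vmax p i + + 1)) (∸-suc p i p<i)) (ring₁ (+ vmax p i)))
    go (tri≈ _ p≡i _) _ = ⊥-elim (p≢i p≡i)
    go (tri> _ _ i<p) (yes refl) = trans (ψ-diff-at-j vmax i (suc i) ℕP.≤-refl) (cong (λ z → + z + + 1) (ℕP.n∸n≡0 i))
    go (tri> _ _ i<p) (no p≢i+1) = trans (cong₂ _-_ (ψ-> vmax (suc i) p i+1<p) (ψ-> vmax i p i<p))
                                         (trans (cong (λ z → - + vmax (suc i) p - - + z) (∸-suc (suc i) p i+1<p)) (ring₂ (+ vmax (suc i) p)))
      where
      i+1<p : suc i ℕ.< p
      i+1<p = ℕP.≤∧≢⇒< i<p (λ e → p≢i+1 (sym e))

  Fwin-vmax-step : ∀ i → 1 ℕ.≤ i → suc i ℕ.≤ N → Fwin N vmax (suc i) ≡ Fwin N vmax i + (Nℤ - + 1)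
  Fwin-vmax-step i 1≤i i<N =
    trans (ring₁ (Fwin N vmax (suc i)) (Fwin N vmax i))
          (cong (λ z → Fwin N vmax i + z) (trans (Fwin-diff≡sumψ-diff vmax i (suc i) 1≤i ℕP.≤-refl i<N) (trans sum (ring₂ Nℤ))))
    where
    ring₁ : ∀ a b → a ≡ b + (a - b)
    ring₁ = solve-∀
    ring₂ : ∀ n → + 1 * n + - + 1 ≡ n - + 1
    ring₂ = solve-∀
    sum : sumToℤ N (ψ-diff vmax i (suc i)) ≡ + 1 * Nℤ + - + 1
    sum = trans (sumToℤ-bump N (λ _ → + 1) (ψ-diff vmax i (suc i)) i (- + 1) 1≤i (ℕP.<⇒≤ i<N)
                  (trans (ψ-diff-at-i vmax i (suc i) ℕP.≤-refl) (cong +_ (ℕP.n∸n≡0 i)))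
                  (λ p p≢i → ψ-diff-vmax i p 1≤i p≢i))
                (cong (_+ - + 1) (sumToℤ-const N (+ 1)))

  Fwin-vmax : ∀ i → 1 ℕ.≤ i → i ℕ.≤ N → Fwin N vmax i ≡ cwin N i
  Fwin-vmax (suc zero)    _ _   = Fwin-vmax-1
  Fwin-vmax (suc (suc i)) _ i<N = trans (Fwin-vmax-step (suc i) (s≤s z≤n) i<N)
                                        (cong (_+ (Nℤ - + 1)) (Fwin-vmax (suc i) (s≤s z≤n) (ℕP.<⇒≤ i<N)))

  F-vmax≗fc : F vmax ≗ fc N
  F-vmax≗fc = ext-cong (Fwin N vmax) (cwin N) Fwin-vmax

  Len-F-v₀ : Len N (F v₀) 0
  Len-F-v₀ = Len-≗ (λ x → sym (ext-Fwin-v₀ x)) 0 Len-id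

  F-v₀≤F : ∀ v → Admitted N v → LeftWeak N (F v₀) (F v) × ∃ (Len N (F v))
  F-v₀≤F v adm = ≤T⇒leftWeak (total v ∸ total v₀) v₀ v v₀-admitted adm v₀≤v (ℕP.m+[n∸m]≡n (total-mono-≤ v₀ v v₀≤v)) 0 Len-F-v₀
    where
    v₀≤v : v₀ ≤[ N ]T v
    v₀≤v _ _ _ = z≤n

  ≤T⇒F-leftWeak : ∀ v w → Admitted N v → Admitted N w → v ≤[ N ]T w → LeftWeak N (F v) (F w)
  ≤T⇒F-leftWeak v w adm-v adm-w v≤w =
    let (ℓ , Lv) = proj₂ (F-v₀≤F v adm-v)
    in proj₁ (≤T⇒leftWeak (total w ∸ total v) v w adm-v adm-w v≤w (ℕP.m+[n∸m]≡n (total-mono-≤ v w v≤w)) ℓ Lv)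

  -- v_ij > 0 makes (j, i + v_ij N) an inversion of F v; it survives in F w, so v_ij ≤ w_ij.
  F-leftWeak⇒≤T : ∀ v w → Admitted N v → Admitted N w → LeftWeak N (F v) (F w) → v ≤[ N ]T w
  F-leftWeak⇒≤T v w adm-v adm-w v≤w i j (1≤i , i<j , j≤N) with v i j ℕ.≟ 0
  ... | yes vij≡0 = subst (ℕ._≤ w i j) (sym vij≡0) z≤n
  ... | no vij≢0 = +≤+⁻¹ (proj₂ (proj₂ (inversion⇒floor (Fwin N w) w (Fwin-floorTable w adm-w) j i (+ v i j) 1≤j j≤N 1≤i i≤N
                     (proj₂ (leftWeak⇒Inv⊆ (F v) (F w) (F-periodicBijection v adm-v) v≤w) _ inv-v))))
    where
    i≤N = ℕP.≤-trans (ℕP.<⇒≤ i<j) j≤N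
    1≤j = ℕP.≤-trans 1≤i (ℕP.<⇒≤ i<j)
    inv-v : Inv N (F v) (+ j , + i + + v i j * Nℤ)
    inv-v = floor⇒inversion (Fwin N v) v (Fwin-floorTable v adm-v) i j (+ v i j) 1≤i i<j j≤N (+≤+ (ℕP.n≢0⇒n>0 vij≢0)) ℤP.≤-refl

  F-in-interval : ∀ v → Admitted N v → InInterval N (F v)
  F-in-interval v adm =
    (bijective , ext-periodic a , window-sum) ,
    leftWeak-≗ˡ ext-Fwin-v₀ (proj₁ (F-v₀≤F v adm)) ,
    leftWeak-≗ʳ (≤T⇒F-leftWeak v vmax adm vmax-admitted (≤vmax v adm)) F-vmax≗fc
    where
    a = Fwin N v
    table = Fwin-floorTable v adm
    bijective = (λ {x} {y} e → ext-injective a v table x y e) ,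
                (λ y → proj₁ (ext-surjective a v table y) , λ {z} z≡x → trans (cong (F v) z≡x) (proj₂ (ext-surjective a v table y)))
    window-sum : + 2 * sumToℤ N (λ i → F v (+ i)) ≡ + (N ℕ.* suc N)
    window-sum = trans (cong (+ 2 *_) (sumToℤ-cong N _ _ (λ i 1≤i i≤N → ext-pos a i 1≤i i≤N))) (Fwin-sum v)

  F-injective : ∀ v w → Admitted N v → Admitted N w → F v ≗ F w → ∀ i j → InT N i j → v i j ≡ w i j
  F-injective v w adm-v adm-w Fv≗Fw i j (1≤i , i<j , j≤N) = +-injective (≤-antisym (same-floor fv fw d) (same-floor fw fv (sym d)))
    where
    a = Fwin N v
    b = Fwin N w
    same-window : ∀ k → 1 ℕ.≤ k → k ℕ.≤ N → a k ≡ b k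
    same-window k 1≤k k≤N = trans (sym (ext-pos a k 1≤k k≤N)) (trans (Fv≗Fw (+ k)) (ext-pos b k 1≤k k≤N))
    d : a j - a i ≡ b j - b i
    d = cong₂ _-_ (same-window j (ℕP.≤-trans 1≤i (ℕP.<⇒≤ i<j)) j≤N) (same-window i 1≤i (ℕP.≤-trans (ℕP.<⇒≤ i<j) j≤N))
    fv : StrictFloor (a j - a i) (+ v i j)
    fv = Fwin-floorTable v adm-v i j 1≤i i<j j≤N
    fw : StrictFloor (b j - b i) (+ w i j)
    fw = Fwin-floorTable w adm-w i j 1≤i i<j j≤N
    same-floor : ∀ {d d' x y} → StrictFloor d x → StrictFloor d' y → d ≡ d' → x ≤ y
    same-floor fx fy refl = floor-maximal fy (StrictFloor.lower fx)

  -- Induction along a chain of covers from id, keeping every inversion below those of f_c = F vmax.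
  leftWeak-from-id⇒F : ∀ h → LeftWeak N (λ x → x) h → (∀ Q → Inv N h Q → Inv N (F vmax) Q) →
                       ∃ λ v → Admitted N v × F v ≗ h
  leftWeak-from-id⇒F h (≤-refl id≗h) _ = v₀ , v₀-admitted , λ x → trans (ext-Fwin-v₀ x) (id≗h x)
  leftWeak-from-id⇒F h (≤-step {g = g} id≤g cover) h⊆vmax with cover-structure g h bij-g cover
    where
    bij-g : PeriodicBijection g
    bij-g = proj₁ (leftWeak⇒Inv⊆ (λ x → x) g ((λ _ _ e → e) , (λ z → z , refl) , (λ _ → refl)) id≤g)
  ... | record { x = x ; y = y ; 1≤x = 1≤x ; x≤N = x≤N ; ascent = ascent ; swap = swap ; oneMore = oneMore }
    with leftWeak-from-id⇒F g id≤g (λ Q q → h⊆vmax Q (OneMoreInversion.old⊆ oneMore Q q)) | window-position x 1≤x x≤N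
  ... | v , adm , Fv≗g | c , 1≤c , c≤N , c≡x = Raised.v' raised , Raised.admitted raised , Fv'≗h
    where
    Fv-c≡gx : F v (+ c) ≡ g x
    Fv-c≡gx = trans (Fv≗g (+ c)) (cong g c≡x)
    raised = raise v vmax adm vmax-admitted c y 1≤c c≤N
               (trans (Fv≗g y) (trans ascent (cong (_+ + 1) (sym Fv-c≡gx))))
               (subst (λ z → Inv N (F vmax) (z , y)) (sym c≡x) (h⊆vmax (x , y) (OneMoreInversion.new∈ oneMore)))
    Fv'≗h : F (Raised.v' raised) ≗ h
    Fv'≗h u = trans (Raised.swap raised u) (trans (cong₂ sAt Fv-c≡gx (Fv≗g u)) (sym (swap u)))

  F-onto-interval : ∀ g → InInterval N g → ∃ λ v → Admitted N v × F v ≗ g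
  F-onto-interval g ((bijective , per , _) , id≤g , g≤fc) = leftWeak-from-id⇒F g id≤g g⊆vmax
    where
    bij-g : PeriodicBijection g
    bij-g = (λ x y e → proj₁ bijective e) , (λ z → proj₁ (proj₂ bijective z) , proj₂ (proj₂ bijective z) refl) , per
    g⊆vmax : ∀ Q → Inv N g Q → Inv N (F vmax) Q
    g⊆vmax Q q = Inv-≗ (λ z → sym (F-vmax≗fc z)) Q (proj₂ (leftWeak⇒Inv⊆ g (fc N) bij-g g≤fc) Q q)

  F-order-iso : ∀ v w → Admitted N v → Admitted N w → (v ≤[ N ]T w) ⇔ LeftWeak N (F v) (F w)
  F-order-iso v w adm-v adm-w = mk⇔ (≤T⇒F-leftWeak v w adm-v adm-w) (F-leftWeak⇒≤T v w adm-v adm-w)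

theorem6p3 : (n : ℕ) → 2 ℕ.≤ n →
    ((v : ℕ → ℕ → ℕ) → Admitted n v → InInterval n (ext n (Fwin n v))) ×
    ((v w : ℕ → ℕ → ℕ) → Admitted n v → Admitted n w →
       (∀ x → ext n (Fwin n v) x ≡ ext n (Fwin n w) x) →
       ∀ i j → InT n i j → v i j ≡ w i j) ×
    ((g : ℤ → ℤ) → InInterval n g →
       Σ (ℕ → ℕ → ℕ) λ v → Admitted n v × (∀ x → ext n (Fwin n v) x ≡ g x)) ×
    ((v w : ℕ → ℕ → ℕ) → Admitted n v → Admitted n w →
       (v ≤[ n ]T w) ⇔ LeftWeak n (ext n (Fwin n v)) (ext n (Fwin n w)))
theorem6p3 0 ()
theorem6p3 1 (s≤s ())
theorem6p3 (suc (suc m)) _ = F-in-interval , F-injective , F-onto-interval , F-order-iso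
  where open Theorem m
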